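{- For every integer $n\geq 0$, \begin{align*} \overline{p}_{ -5}(8n+1) &\equiv 0 \pmod{2}, & \overline{p}_{ -5}(8n+2) &\equiv 0 \pmod{4}, & \overline{p}_{ -5}(8n+3) &\equiv 0 \pmod{8}, \\ \overline{p}_{ -5}(8n+4) &\equiv 0 \pmod{2}, & \overline{p}_{ -5}(8n+5) &\equiv 0 \pmod{8}, & \overline{p}_{ -5}(8n+6) &\equiv 0 \pmod{8}, \end{align*} and \[ \overline{p}_{ -5}(8n+7) \equiv 0 \pmod{128}. \]
   Context: For $|q|<1$ let $(a;q)_\infty=\prod_{i\geq 0}(1-aq^i)$. For a positive integer $t$, the number $\overline{p}_{ -t}(n)$ of $t$-colored overpartitions of $n$ is defined by the generating function \[ \sum_{n\geq 0}\overline{p}_{ -t}(n)q^n=\frac{(q^2;q^2)_\infty^t}{(q;q)_\infty^{2t}}. \] -}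

module Defs where

open import Data.Nat as ℕ using (ℕ; zero; suc; _∸_; _≡ᵇ_)
open import Data.Nat.DivMod using (_%_)
open import Data.Integer as ℤ using (ℤ; +_; -_; 0ℤ; 1ℤ)
open import Data.Bool using (if_then_else_)

-- Formal power series in q with integer coefficients,
-- represented by their coefficient sequence: f n = [q^n] f.
Series : Set
Series = ℕ → ℤ

one : Series
one zero    = 1ℤ
one (suc _) = 0ℤ

sumTo : ℕ → (ℕ → ℤ) → ℤ
sumTo zero    f = f zero
sumTo (suc n) f = sumTo n f ℤ.+ f (suc n)

_⊛_ : Series → Series → Series
(f ⊛ g) n = sumTo n (λ i → f i ℤ.* g (n ∸ i))

infixl 7 _⊛_

pow : Series → ℕ → Series
pow f zero    = one
pow f (suc m) = f ⊛ pow f m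

-- the series 1 - q^k  (k ≥ 1 intended)
oneMinusQ^ : ℕ → Series
oneMinusQ^ k zero    = 1ℤ
oneMinusQ^ k (suc m) = if (suc m ≡ᵇ k) then - 1ℤ else 0ℤ

invOneMinusQ^suc : ℕ → Series
invOneMinusQ^suc j n = if (n % suc j ≡ᵇ 0) then 1ℤ else 0ℤ

prodTo : ℕ → (ℕ → Series) → Series
prodTo zero    F = one
prodTo (suc N) F = prodTo N F ⊛ F (suc N)

-- Truncation of (q^2;q^2)_∞^5 / (q;q)_∞^{10}
--   = prod_{k=1}^{N} (1 - q^{2k})^5 * prod_{k=1}^{N} (1/(1 - q^k))^{10}.
-- For N ≥ n its coefficient of q^n equals that of the infinite product,
-- since all omitted factors are ≡ 1 mod q^{N+1}.
genTrunc : ℕ → Series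
genTrunc N =
  prodTo N (λ k → pow (oneMinusQ^ (2 ℕ.* k)) 5)
  ⊛ prodTo N (λ k → pow (invOneMinusQ^suc (k ∸ 1)) 10)

-- \overline{p}_{-5}(n): the number of 5-colored overpartitions of n,
-- the coefficient of q^n in (q^2;q^2)_∞^5 / (q;q)_∞^{10}.
pbar-5 : ℕ → ℤ
pbar-5 n = genTrunc n n

module Submission where

-- By Gauss, φ(-q) = Σ_{k∈ℤ} (-1)^k q^{k²} equals (q; q)²_∞/(q²; q²)_∞, so the generating function
-- is 1/φ(-q)^5. Gauss's identity follows from the finite Jacobi triple product
-- Σ_j (-1)^{j-M} q^{(j-M)²} [2M, j]_{q²} = (q; q²)_M², itself an iterate of the q-binomial theorem,
-- by multiplying with (q²; q²)_M and reducing modulo q^{M+1}.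
--
-- Write φ(-q) = 1 + 2U. Modulo 2^7, 1/(1 + 2U)^5 is the polynomial P(U) formed by the first seven
-- terms of its binomial series. Squares are 0, 1 or 4 modulo 8, so U = a + b + c with a, b and c
-- supported on exponents ≡ 1, 4 and 0 (mod 8), and a monomial a^i b^j c^k only contributes to
-- exponents ≡ i + 4j (mod 8). The congruences follow by checking the 2-adic valuations of the 84
-- coefficients of P(a + b + c) against their residue classes.

open import Defs

open import Algebra.Bundles using (CommutativeRing)
open import Algebra.Solver.Ring.AlmostCommutativeRing using (_-Raw-AlmostCommutative⟶_; fromCommutativeRing)
open import Data.Bool using (Bool; true; false; if_then_else_; _∨_) renaming (T to IsTrue)
open import Data.Empty using (⊥-elim)
open import Data.Fin using (zero; suc)
open import Data.Integer as ℤ using (ℤ; -_; 0ℤ; 1ℤ; _+_; _*_)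
import Data.Integer.Properties as ℤ
open import Data.Integer.Divisibility using () renaming (_∣_ to _∣ᵤ_)
open import Data.Integer.Divisibility.Signed using (_∣_; divides; _∣?_; ∣m∣n⇒∣m+n; ∣m⇒∣m*n; ∣⇒∣ᵤ)
open import Data.Integer.Tactic.RingSolver using (solve-∀)
open import Data.List using (List; []; _∷_; applyUpTo; upTo; map; concatMap)
open import Data.List.Relation.Unary.All using (All; []; _∷_; all?)
open import Data.Maybe using (Maybe; just; nothing)
open import Data.Nat as ℕ using (ℕ; zero; suc; _∸_; z≤n; s≤s; ∣_-_∣)
import Data.Nat.Properties as ℕ
open import Data.Nat.Combinatorics using (_C_)
open import Data.Nat.DivMod
  using (_%_; m<n⇒m%n≡m; m≤n⇒[n∸m]%m≡n%m; m%n<n; m%n%n≡m%n; %-distribˡ-+; %-distribˡ-*; [m+kn]%n≡m%n)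
open import Data.Nat.Tactic.RingSolver using () renaming (solve-∀ to ℕ-solve-∀)
open import Data.Product using (_×_; _,_)
open import Data.Sum using (inj₁; inj₂)
open import Data.Unit using (tt)
open import Data.Vec using (Vec; []; _∷_)
open import Function using (case_of_)
open import Level using (0ℓ)
open import Relation.Binary.PropositionalEquality
import Relation.Binary.Reasoning.Setoid as SetoidReasoning
open import Relation.Nullary using (yes; no)
open import Relation.Nullary.Decidable using (from-yes)

sumTo-cong-≤ : ∀ n {f g : ℕ → ℤ} → (∀ i → i ℕ.≤ n → f i ≡ g i) → sumTo n f ≡ sumTo n g
sumTo-cong-≤ zero    f≗g = f≗g 0 z≤n
sumTo-cong-≤ (suc n) f≗g =
  cong₂ _+_ (sumTo-cong-≤ n (λ i i≤n → f≗g i (ℕ.m≤n⇒m≤1+n i≤n))) (f≗g (suc n) ℕ.≤-refl)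

sumTo-cong : ∀ n {f g : ℕ → ℤ} → (∀ i → f i ≡ g i) → sumTo n f ≡ sumTo n g
sumTo-cong n f≗g = sumTo-cong-≤ n (λ i _ → f≗g i)

sumTo-+ : ∀ n (f g : ℕ → ℤ) → sumTo n (λ i → f i + g i) ≡ sumTo n f + sumTo n g
sumTo-+ zero    f g = refl
sumTo-+ (suc n) f g rewrite sumTo-+ n f g =
  interchange (sumTo n f) (sumTo n g) (f (suc n)) (g (suc n))
  where
  interchange : ∀ a b c d → (a + b) + (c + d) ≡ (a + c) + (b + d)
  interchange = solve-∀

sumTo-*ˡ : ∀ n c (f : ℕ → ℤ) → c * sumTo n f ≡ sumTo n (λ i → c * f i)
sumTo-*ˡ zero    c f = refl
sumTo-*ˡ (suc n) c f rewrite sym (sumTo-*ˡ n c f) = ℤ.*-distribˡ-+ c (sumTo n f) (f (suc n))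

sumTo-*ʳ : ∀ n c (f : ℕ → ℤ) → sumTo n f * c ≡ sumTo n (λ i → f i * c)
sumTo-*ʳ n c f = trans (ℤ.*-comm (sumTo n f) c)
  (trans (sumTo-*ˡ n c f) (sumTo-cong n (λ i → ℤ.*-comm c (f i))))

sumTo-zero : ∀ n → sumTo n (λ _ → 0ℤ) ≡ 0ℤ
sumTo-zero zero = refl
sumTo-zero (suc n) rewrite sumTo-zero n = refl

sumTo-unfoldˡ : ∀ n (f : ℕ → ℤ) → sumTo (suc n) f ≡ f 0 + sumTo n (λ i → f (suc i))
sumTo-unfoldˡ zero    f = refl
sumTo-unfoldˡ (suc n) f rewrite sumTo-unfoldˡ n f =
  ℤ.+-assoc (f 0) (sumTo n (λ i → f (suc i))) (f (suc (suc n)))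

sumTo-reverse : ∀ n (f : ℕ → ℤ) → sumTo n f ≡ sumTo n (λ i → f (n ∸ i))
sumTo-reverse zero    f = refl
sumTo-reverse (suc n) f = begin
  sumTo n f + f (suc n)                      ≡⟨ cong (_+ f (suc n)) (sumTo-reverse n f) ⟩
  sumTo n (λ i → f (n ∸ i)) + f (suc n)      ≡⟨ ℤ.+-comm _ (f (suc n)) ⟩
  f (suc n) + sumTo n (λ i → f (n ∸ i))      ≡⟨ sumTo-unfoldˡ n (λ i → f (suc n ∸ i)) ⟨
  sumTo (suc n) (λ i → f (suc n ∸ i))        ∎
  where open ≡-Reasoning

sumTo-triangle : ∀ n (F : ℕ → ℕ → ℤ) →
  sumTo n (λ i → sumTo i (λ j → F j i)) ≡ sumTo n (λ j → sumTo (n ∸ j) (λ k → F j (j ℕ.+ k)))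
sumTo-triangle zero    F = refl
sumTo-triangle (suc n) F = begin
    sumTo n (λ i → sumTo i (λ j → F j i)) + sumTo (suc n) (λ j → F j (suc n))
  ≡⟨ cong (_+ sumTo (suc n) (λ j → F j (suc n))) (sumTo-triangle n F) ⟩
    R n + (sumTo n (λ j → F j (suc n)) + F (suc n) (suc n))
  ≡⟨ ℤ.+-assoc (R n) _ _ ⟨
    (R n + sumTo n (λ j → F j (suc n))) + F (suc n) (suc n)
  ≡⟨ cong₂ _+_ (sym (sumTo-+ n _ _)) (cong (F (suc n)) (sym (ℕ.+-identityʳ (suc n)))) ⟩
    sumTo n (λ j → R[ n ] j + F j (suc n)) + F (suc n) (suc n ℕ.+ 0)
  ≡⟨ cong (_+ F (suc n) (suc n ℕ.+ 0)) (sumTo-cong-≤ n extend) ⟩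
    sumTo n (R[ suc n ]) + F (suc n) (suc n ℕ.+ 0)
  ≡⟨ cong (λ z → sumTo n (R[ suc n ]) + sumTo z (λ k → F (suc n) (suc n ℕ.+ k))) (ℕ.n∸n≡0 n) ⟨
    sumTo (suc n) (R[ suc n ]) ∎
  where
  open ≡-Reasoning
  R[_] : ℕ → ℕ → ℤ
  R[ m ] j = sumTo (m ∸ j) (λ k → F j (j ℕ.+ k))
  R : ℕ → ℤ
  R m = sumTo m R[ m ]
  extend : ∀ j → j ℕ.≤ n → R[ n ] j + F j (suc n) ≡ R[ suc n ] j
  extend j j≤n rewrite ℕ.+-∸-assoc 1 j≤n =
    cong (λ z → R[ n ] j + F j z) (sym (trans (ℕ.+-suc j (n ∸ j)) (cong suc (ℕ.m+[n∸m]≡n j≤n))))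

-- The ring of formal power series

infix 4 _≈_
record _≈_ (f g : Series) : Set where
  constructor mk≈
  field at : ∀ n → f n ≡ g n
open _≈_ public

≈-refl : ∀ {f} → f ≈ f
≈-refl = mk≈ λ _ → refl

≈-sym : ∀ {f g} → f ≈ g → g ≈ f
≈-sym f≈g = mk≈ λ n → sym (at f≈g n)

≈-trans : ∀ {f g h} → f ≈ g → g ≈ h → f ≈ h
≈-trans f≈g g≈h = mk≈ λ n → trans (at f≈g n) (at g≈h n)

⊛-cong : ∀ {f f′ g g′} → f ≈ f′ → g ≈ g′ → f ⊛ g ≈ f′ ⊛ g′
⊛-cong f≈f′ g≈g′ = mk≈ λ n → sumTo-cong n (λ i → cong₂ _*_ (at f≈f′ i) (at g≈g′ (n ∸ i)))

⊛-comm : ∀ f g → f ⊛ g ≈ g ⊛ f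
⊛-comm f g = mk≈ λ n → trans (sumTo-reverse n _) (sumTo-cong-≤ n (λ i i≤n →
  trans (cong (λ k → f (n ∸ i) * g k) (ℕ.m∸[m∸n]≡n i≤n)) (ℤ.*-comm (f (n ∸ i)) (g i))))

⊛-assoc : ∀ f g h → (f ⊛ g) ⊛ h ≈ f ⊛ (g ⊛ h)
⊛-assoc f g h = mk≈ assoc-at
  where
  open ≡-Reasoning
  reindex : ∀ n j k → f j * g (j ℕ.+ k ∸ j) * h (n ∸ (j ℕ.+ k)) ≡ f j * (g k * h (n ∸ j ∸ k))
  reindex n j k = trans (cong₂ (λ a b → f j * g a * h b) (ℕ.m+n∸m≡n j k) (sym (ℕ.∸-+-assoc n j k)))
                        (ℤ.*-assoc (f j) (g k) (h (n ∸ j ∸ k)))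
  assoc-at : ∀ n → ((f ⊛ g) ⊛ h) n ≡ (f ⊛ (g ⊛ h)) n
  assoc-at n = begin
      sumTo n (λ i → sumTo i (λ j → f j * g (i ∸ j)) * h (n ∸ i))
    ≡⟨ sumTo-cong n (λ i → sumTo-*ʳ i (h (n ∸ i)) (λ j → f j * g (i ∸ j))) ⟩
      sumTo n (λ i → sumTo i (λ j → f j * g (i ∸ j) * h (n ∸ i)))
    ≡⟨ sumTo-triangle n (λ j i → f j * g (i ∸ j) * h (n ∸ i)) ⟩
      sumTo n (λ j → sumTo (n ∸ j) (λ k → f j * g (j ℕ.+ k ∸ j) * h (n ∸ (j ℕ.+ k))))
    ≡⟨ sumTo-cong n (λ j → trans (sumTo-cong (n ∸ j) (reindex n j))
                                 (sym (sumTo-*ˡ (n ∸ j) (f j) (λ k → g k * h (n ∸ j ∸ k))))) ⟩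
      sumTo n (λ j → f j * sumTo (n ∸ j) (λ k → g k * h (n ∸ j ∸ k))) ∎

⊛-identityˡ : ∀ f → one ⊛ f ≈ f
⊛-identityˡ f = mk≈ λ n → go n (λ i → f (n ∸ i))
  where
  go : ∀ n (g : ℕ → ℤ) → sumTo n (λ i → one i * g i) ≡ g 0
  go zero    g = ℤ.*-identityˡ (g 0)
  go (suc n) g rewrite go n g = ℤ.+-identityʳ (g 0)

𝟘 : Series
𝟘 _ = 0ℤ

infixl 6 _⊕_
infixl 7 _⊗_

-- Kept opaque so that the ring solver treats series as atoms instead of unfolding them.
opaque
  _⊕_ : Series → Series → Series
  (f ⊕ g) n = f n + g n

  ⊖_ : Series → Series
  (⊖ f) n = - f n

  _⊗_ : Series → Series → Series
  _⊗_ = _⊛_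

opaque
  unfolding _⊕_ ⊖_ _⊗_

  ⊕-at : ∀ f g n → (f ⊕ g) n ≡ f n + g n
  ⊕-at f g n = refl

  ⊖-at : ∀ f n → (⊖ f) n ≡ - f n
  ⊖-at f n = refl

  ⊛≈⊗ : ∀ f g → f ⊛ g ≈ f ⊗ g
  ⊛≈⊗ f g = ≈-refl

  ⊕-cong : ∀ {f f′ g g′} → f ≈ f′ → g ≈ g′ → f ⊕ g ≈ f′ ⊕ g′
  ⊕-cong f≈f′ g≈g′ = mk≈ λ n → cong₂ _+_ (at f≈f′ n) (at g≈g′ n)

  ⊕-assoc : ∀ f g h → (f ⊕ g) ⊕ h ≈ f ⊕ (g ⊕ h)
  ⊕-assoc f g h = mk≈ λ n → ℤ.+-assoc (f n) (g n) (h n)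

  ⊕-comm : ∀ f g → f ⊕ g ≈ g ⊕ f
  ⊕-comm f g = mk≈ λ n → ℤ.+-comm (f n) (g n)

  ⊕-identityˡ : ∀ f → 𝟘 ⊕ f ≈ f
  ⊕-identityˡ f = mk≈ λ n → ℤ.+-identityˡ (f n)

  ⊕-identityʳ : ∀ f → f ⊕ 𝟘 ≈ f
  ⊕-identityʳ f = mk≈ λ n → ℤ.+-identityʳ (f n)

  ⊕-inverseˡ : ∀ f → ⊖ f ⊕ f ≈ 𝟘
  ⊕-inverseˡ f = mk≈ λ n → ℤ.+-inverseˡ (f n)

  ⊕-inverseʳ : ∀ f → f ⊕ ⊖ f ≈ 𝟘
  ⊕-inverseʳ f = mk≈ λ n → ℤ.+-inverseʳ (f n)

  ⊖-cong : ∀ {f f′} → f ≈ f′ → ⊖ f ≈ ⊖ f′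
  ⊖-cong f≈f′ = mk≈ λ n → cong -_ (at f≈f′ n)

  ⊗-distribˡ-⊕ : ∀ f g h → f ⊗ (g ⊕ h) ≈ f ⊗ g ⊕ f ⊗ h
  ⊗-distribˡ-⊕ f g h = mk≈ λ n →
    trans (sumTo-cong n (λ i → ℤ.*-distribˡ-+ (f i) (g (n ∸ i)) (h (n ∸ i)))) (sumTo-+ n _ _)

≈⊛⊗ : ∀ f g → f ⊗ g ≈ f ⊛ g
≈⊛⊗ f g = ≈-sym (⊛≈⊗ f g)

⊗-cong : ∀ {f f′ g g′} → f ≈ f′ → g ≈ g′ → f ⊗ g ≈ f′ ⊗ g′
⊗-cong f≈f′ g≈g′ = ≈-trans (≈⊛⊗ _ _) (≈-trans (⊛-cong f≈f′ g≈g′) (⊛≈⊗ _ _))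

⊗-comm : ∀ f g → f ⊗ g ≈ g ⊗ f
⊗-comm f g = ≈-trans (≈⊛⊗ f g) (≈-trans (⊛-comm f g) (⊛≈⊗ g f))

⊗-assoc : ∀ f g h → (f ⊗ g) ⊗ h ≈ f ⊗ (g ⊗ h)
⊗-assoc f g h = ≈-trans (≈⊛⊗ (f ⊗ g) h) (≈-trans (⊛-cong {g = h} (≈⊛⊗ f g) ≈-refl)
  (≈-trans (⊛-assoc f g h) (≈-trans (⊛-cong {f = f} ≈-refl (⊛≈⊗ g h)) (⊛≈⊗ f (g ⊗ h)))))

⊗-identityˡ : ∀ f → one ⊗ f ≈ f
⊗-identityˡ f = ≈-trans (≈⊛⊗ one f) (⊛-identityˡ f)

⊗-identityʳ : ∀ f → f ⊗ one ≈ f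
⊗-identityʳ f = ≈-trans (⊗-comm f one) (⊗-identityˡ f)

⊗-distribʳ-⊕ : ∀ f g h → (g ⊕ h) ⊗ f ≈ g ⊗ f ⊕ h ⊗ f
⊗-distribʳ-⊕ f g h = ≈-trans (⊗-comm (g ⊕ h) f)
  (≈-trans (⊗-distribˡ-⊕ f g h) (⊕-cong (⊗-comm f g) (⊗-comm f h)))

seriesRing : CommutativeRing 0ℓ 0ℓ
seriesRing = record
  { Carrier = Series ; _≈_ = _≈_ ; _+_ = _⊕_ ; _*_ = _⊗_ ; -_ = ⊖_ ; 0# = 𝟘 ; 1# = one
  ; isCommutativeRing = record
    { isRing = record
      { +-isAbelianGroup = record
        { isGroup = record
          { isMonoid = record
            { isSemigroup = record
              { isMagma = record
                { isEquivalence = record { refl = ≈-refl ; sym = ≈-sym ; trans = ≈-trans }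
                ; ∙-cong = ⊕-cong }
              ; assoc = ⊕-assoc }
            ; identity = ⊕-identityˡ , ⊕-identityʳ }
          ; inverse = ⊕-inverseˡ , ⊕-inverseʳ
          ; ⁻¹-cong = ⊖-cong }
        ; comm = ⊕-comm }
      ; *-cong = ⊗-cong
      ; *-assoc = ⊗-assoc
      ; *-identity = ⊗-identityˡ , ⊗-identityʳ
      ; distrib = ⊗-distribˡ-⊕ , ⊗-distribʳ-⊕ }
    ; *-comm = ⊗-comm } }

module SeriesReasoning = SetoidReasoning (CommutativeRing.setoid seriesRing)

⊕-congˡ : ∀ {f g h} → g ≈ h → f ⊕ g ≈ f ⊕ h
⊕-congˡ = ⊕-cong ≈-refl

⊕-congʳ : ∀ {f g h} → g ≈ h → g ⊕ f ≈ h ⊕ f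
⊕-congʳ g≈h = ⊕-cong g≈h ≈-refl

⊗-congˡ : ∀ {f g h} → g ≈ h → f ⊗ g ≈ f ⊗ h
⊗-congˡ = ⊗-cong ≈-refl

⊗-congʳ : ∀ {f g h} → g ≈ h → g ⊗ f ≈ h ⊗ f
⊗-congʳ g≈h = ⊗-cong g≈h ≈-refl

⊗-zeroʳ : ∀ f → f ⊗ 𝟘 ≈ 𝟘
⊗-zeroʳ f = ≈-trans (≈⊛⊗ f 𝟘) (mk≈ λ n → trans (sumTo-cong n (λ i → ℤ.*-zeroʳ (f i))) (sumTo-zero n))

const : ℤ → Series
const c zero    = c
const c (suc _) = 0ℤ

one≈const1 : one ≈ const 1ℤ
one≈const1 = mk≈ λ { zero → refl ; (suc n) → refl }

const-⊛ : ∀ c f n → (const c ⊛ f) n ≡ c * f n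
const-⊛ c f zero    = refl
const-⊛ c f (suc n) = begin
  (const c ⊛ f) (suc n)                               ≡⟨ sumTo-unfoldˡ n _ ⟩
  c * f (suc n) + sumTo n (λ i → 0ℤ * f (n ∸ i))      ≡⟨ cong (c * f (suc n) +_) tail≡0 ⟩
  c * f (suc n) + 0ℤ                                  ≡⟨ ℤ.+-identityʳ _ ⟩
  c * f (suc n)                                       ∎
  where
  open ≡-Reasoning
  tail≡0 : sumTo n (λ i → 0ℤ * f (n ∸ i)) ≡ 0ℤ
  tail≡0 = trans (sumTo-cong n (λ i → ℤ.*-zeroˡ (f (n ∸ i)))) (sumTo-zero n)

const-⊗ : ∀ c f → const c ⊗ f ≈ λ n → c * f n
const-⊗ c f = ≈-trans (≈⊛⊗ (const c) f) (mk≈ (const-⊛ c f))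

const-homomorphism : ℤ.+-*-rawRing -Raw-AlmostCommutative⟶ fromCommutativeRing seriesRing
const-homomorphism = record
  { ⟦_⟧    = const
  ; +-homo = λ a b → mk≈ λ where
      zero    → sym (⊕-at (const a) (const b) 0)
      (suc n) → sym (⊕-at (const a) (const b) (suc n))
  ; *-homo = λ a b → ≈-sym (≈-trans (const-⊗ a (const b)) (mk≈ λ { zero → refl ; (suc n) → ℤ.*-zeroʳ a }))
  ; -‿homo = λ a → mk≈ λ where
      zero    → sym (⊖-at (const a) 0)
      (suc n) → sym (⊖-at (const a) (suc n))
  ; 0-homo = mk≈ λ { zero → refl ; (suc n) → refl }
  ; 1-homo = mk≈ λ { zero → refl ; (suc n) → refl }
  }

const-≟ : ∀ a b → Maybe (const a ≈ const b)
const-≟ a b with a ℤ.≟ b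
... | yes a≡b = just (mk≈ λ n → cong (λ c → const c n) a≡b)
... | no  _   = nothing

open import Algebra.Solver.Ring ℤ.+-*-rawRing (fromCommutativeRing seriesRing) const-homomorphism const-≟
  using (solve; prove; _:=_; con; var; _:+_; _:*_; :-_; Polynomial; ⟦_⟧)

-- Congruences modulo powers of q

infix 4 _≈[_]_
record _≈[_]_ (f : Series) (m : ℕ) (g : Series) : Set where
  constructor mk≈[]
  field below : ∀ n → n ℕ.< m → f n ≡ g n
open _≈[_]_ public

≈⇒≈[] : ∀ {f g m} → f ≈ g → f ≈[ m ] g
≈⇒≈[] f≈g = mk≈[] λ n _ → at f≈g n

≈[]-refl : ∀ {f m} → f ≈[ m ] f
≈[]-refl = mk≈[] λ _ _ → refl

≈[]-sym : ∀ {f g m} → f ≈[ m ] g → g ≈[ m ] f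
≈[]-sym f≈g = mk≈[] λ n n<m → sym (below f≈g n n<m)

≈[]-trans : ∀ {f g h m} → f ≈[ m ] g → g ≈[ m ] h → f ≈[ m ] h
≈[]-trans f≈g g≈h = mk≈[] λ n n<m → trans (below f≈g n n<m) (below g≈h n n<m)

≈[]-weaken : ∀ {f g m m′} → m′ ℕ.≤ m → f ≈[ m ] g → f ≈[ m′ ] g
≈[]-weaken m′≤m f≈g = mk≈[] λ n n<m′ → below f≈g n (ℕ.<-≤-trans n<m′ m′≤m)

⊕-cong[] : ∀ {f f′ g g′ m} → f ≈[ m ] f′ → g ≈[ m ] g′ → f ⊕ g ≈[ m ] f′ ⊕ g′
⊕-cong[] {f} {f′} {g} {g′} f≈f′ g≈g′ = mk≈[] λ n n<m →
  trans (⊕-at f g n) (trans (cong₂ _+_ (below f≈f′ n n<m) (below g≈g′ n n<m)) (sym (⊕-at f′ g′ n)))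

⊛-cong[] : ∀ {f f′ g g′ m} → f ≈[ m ] f′ → g ≈[ m ] g′ → f ⊛ g ≈[ m ] f′ ⊛ g′
⊛-cong[] f≈f′ g≈g′ = mk≈[] λ n n<m → sumTo-cong-≤ n (λ i i≤n →
  cong₂ _*_ (below f≈f′ i (ℕ.≤-<-trans i≤n n<m)) (below g≈g′ (n ∸ i) (ℕ.≤-<-trans (ℕ.m∸n≤m n i) n<m)))

⊗-cong[] : ∀ {f f′ g g′ m} → f ≈[ m ] f′ → g ≈[ m ] g′ → f ⊗ g ≈[ m ] f′ ⊗ g′
⊗-cong[] {f} {f′} {g} {g′} f≈f′ g≈g′ =
  ≈[]-trans (≈⇒≈[] (≈⊛⊗ f g)) (≈[]-trans (⊛-cong[] f≈f′ g≈g′) (≈⇒≈[] (⊛≈⊗ f′ g′)))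

⊗-one[] : ∀ {f g m} → f ≈[ m ] one → g ≈[ m ] one → f ⊗ g ≈[ m ] one
⊗-one[] f≈1 g≈1 = ≈[]-trans (⊗-cong[] f≈1 g≈1) (≈⇒≈[] (⊗-identityˡ one))

≈[]-stable : (f : ℕ → Series) → (∀ k → f (suc k) ≈[ suc k ] f k) → ∀ k e → f (k ℕ.+ e) ≈[ suc k ] f k
≈[]-stable f step k zero    = subst (λ i → f i ≈[ suc k ] f k) (sym (ℕ.+-identityʳ k)) ≈[]-refl
≈[]-stable f step k (suc e) = subst (λ i → f i ≈[ suc k ] f k) (sym (ℕ.+-suc k e))
  (≈[]-trans (≈[]-weaken (s≤s (ℕ.m≤m+n k e)) (step (k ℕ.+ e))) (≈[]-stable f step k e))

diagonal≈[] : (f : ℕ → Series) → (∀ k → f (suc k) ≈[ suc k ] f k) → ∀ N → (λ n → f n n) ≈[ suc N ] f N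
diagonal≈[] f step N = mk≈[] λ n n<1+N →
  sym (trans (cong (λ i → f i n) (sym (ℕ.m+[n∸m]≡n (ℕ.≤-pred n<1+N))))
             (below (≈[]-stable f step n (N ∸ n)) n ℕ.≤-refl))

pow-cong : ∀ {f g} → f ≈ g → ∀ k → pow f k ≈ pow g k
pow-cong f≈g zero    = ≈-refl
pow-cong f≈g (suc k) = ⊛-cong f≈g (pow-cong f≈g k)

pow-cong[] : ∀ {f g m} → f ≈[ m ] g → ∀ k → pow f k ≈[ m ] pow g k
pow-cong[] f≈g zero    = ≈[]-refl
pow-cong[] f≈g (suc k) = ⊛-cong[] f≈g (pow-cong[] f≈g k)

pow-suc : ∀ f k → pow f (suc k) ≈ f ⊗ pow f k
pow-suc f k = ⊛≈⊗ f (pow f k)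

pow-one : ∀ k → pow one k ≈ one
pow-one zero    = ≈-refl
pow-one (suc k) = ≈-trans (pow-suc one k) (≈-trans (⊗-congˡ (pow-one k)) (⊗-identityˡ one))

pow-⊗ : ∀ f g k → pow (f ⊗ g) k ≈ pow f k ⊗ pow g k
pow-⊗ f g zero    = ≈-sym (⊗-identityˡ one)
pow-⊗ f g (suc k) = ≈-trans (pow-suc _ k) (≈-trans (⊗-congˡ (pow-⊗ f g k))
  (≈-trans (interchange f g (pow f k) (pow g k)) (≈-sym (⊗-cong (pow-suc f k) (pow-suc g k)))))
  where
  interchange : ∀ a b x y → (a ⊗ b) ⊗ (x ⊗ y) ≈ (a ⊗ x) ⊗ (b ⊗ y)
  interchange = solve 4 (λ a b x y → (a :* b) :* (x :* y) := (a :* x) :* (b :* y)) ≈-refl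

pow-+ : ∀ f k l → pow f (k ℕ.+ l) ≈ pow f k ⊗ pow f l
pow-+ f zero    l = ≈-sym (⊗-identityˡ _)
pow-+ f (suc k) l = ≈-trans (pow-suc f (k ℕ.+ l)) (≈-trans (⊗-congˡ (pow-+ f k l))
  (≈-trans (≈-sym (⊗-assoc _ _ _)) (⊗-congʳ (≈-sym (pow-suc f k)))))

prodTo-suc : ∀ N F → prodTo (suc N) F ≈ prodTo N F ⊗ F (suc N)
prodTo-suc N F = ⊛≈⊗ (prodTo N F) (F (suc N))

prodTo-cong : ∀ N {F G : ℕ → Series} → (∀ k → F (suc k) ≈ G (suc k)) → prodTo N F ≈ prodTo N G
prodTo-cong zero    F≈G = ≈-refl
prodTo-cong (suc N) F≈G = ⊛-cong (prodTo-cong N F≈G) (F≈G N)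

prodTo-⊗ : ∀ N (F G : ℕ → Series) → prodTo N F ⊗ prodTo N G ≈ prodTo N (λ k → F k ⊗ G k)
prodTo-⊗ zero    F G = ⊗-identityˡ one
prodTo-⊗ (suc N) F G =
  ≈-trans (⊗-cong (prodTo-suc N F) (prodTo-suc N G))
  (≈-trans (interchange (prodTo N F) (F (suc N)) (prodTo N G) (G (suc N)))
  (≈-trans (⊗-congʳ (prodTo-⊗ N F G)) (≈-sym (prodTo-suc N (λ k → F k ⊗ G k)))))
  where
  interchange : ∀ a b c d → (a ⊗ b) ⊗ (c ⊗ d) ≈ (a ⊗ c) ⊗ (b ⊗ d)
  interchange = solve 4 (λ a b c d → (a :* b) :* (c :* d) := (a :* c) :* (b :* d)) ≈-refl

prodTo-one : ∀ N → prodTo N (λ _ → one) ≈ one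
prodTo-one zero    = ≈-refl
prodTo-one (suc N) = ≈-trans (prodTo-suc N _) (≈-trans (⊗-identityʳ _) (prodTo-one N))

prodTo-pow : ∀ N (F : ℕ → Series) e → prodTo N (λ k → pow (F k) e) ≈ pow (prodTo N F) e
prodTo-pow N F zero    = prodTo-one N
prodTo-pow N F (suc e) = ≈-sym (≈-trans (pow-suc (prodTo N F) e)
  (≈-trans (⊗-congˡ (≈-sym (prodTo-pow N F e)))
  (≈-trans (prodTo-⊗ N F (λ k → pow (F k) e)) (prodTo-cong N (λ k → ≈-sym (pow-suc (F (suc k)) e))))))

shift : ℕ → Series → Series
shift zero    f         = f
shift (suc e) f zero    = 0ℤ
shift (suc e) f (suc n) = shift e f n

shift-cong : ∀ e {f g} → f ≈ g → shift e f ≈ shift e g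
shift-cong e {f} {g} f≈g = mk≈ (go e)
  where
  go : ∀ e n → shift e f n ≡ shift e g n
  go zero    n       = at f≈g n
  go (suc e) zero    = refl
  go (suc e) (suc n) = go e n

shift-cong[] : ∀ e {f g m} → f ≈[ m ] g → shift e f ≈[ e ℕ.+ m ] shift e g
shift-cong[] e {f} {g} {m} f≈g = mk≈[] (go e)
  where
  go : ∀ e n → n ℕ.< e ℕ.+ m → shift e f n ≡ shift e g n
  go zero    n       n<m     = below f≈g n n<m
  go (suc e) zero    _       = refl
  go (suc e) (suc n) (s≤s n<) = go e n n<

shift-below : ∀ e f n → n ℕ.< e → shift e f n ≡ 0ℤ
shift-below (suc e) f zero    _         = refl
shift-below (suc e) f (suc n) (s≤s n<e) = shift-below e f n n<e

shift-above : ∀ e f n → e ℕ.≤ n → shift e f n ≡ f (n ∸ e)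
shift-above zero    f n       _         = refl
shift-above (suc e) f (suc n) (s≤s e≤n) = shift-above e f n e≤n

shift-shift : ∀ a b f → shift a (shift b f) ≈ shift (a ℕ.+ b) f
shift-shift a b f = mk≈ (go a)
  where
  go : ∀ a n → shift a (shift b f) n ≡ shift (a ℕ.+ b) f n
  go zero    n       = refl
  go (suc a) zero    = refl
  go (suc a) (suc n) = go a n

shift-⊗ : ∀ e f g → shift e f ⊗ g ≈ shift e (f ⊗ g)
shift-⊗ e f g = ≈-trans (≈⊛⊗ (shift e f) g) (≈-trans (mk≈ (go e)) (shift-cong e (⊛≈⊗ f g)))
  where
  go : ∀ e n → (shift e f ⊛ g) n ≡ shift e (f ⊛ g) n
  go zero    n       = refl
  go (suc e) zero    = ℤ.*-zeroˡ (g 0)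
  go (suc e) (suc n) = begin
    (shift (suc e) f ⊛ g) (suc n)                              ≡⟨ sumTo-unfoldˡ n _ ⟩
    0ℤ * g (suc n) + sumTo n (λ i → shift e f i * g (n ∸ i))   ≡⟨ cong (_+ (shift e f ⊛ g) n) (ℤ.*-zeroˡ (g (suc n))) ⟩
    0ℤ + (shift e f ⊛ g) n                                     ≡⟨ ℤ.+-identityˡ _ ⟩
    (shift e f ⊛ g) n                                          ≡⟨ go e n ⟩
    shift e (f ⊛ g) n                                          ∎
    where open ≡-Reasoning

-- Opaque so that unification can match monomial e c against monomial e′ c′.
opaque
  monomial : ℕ → ℤ → Series
  monomial e c = shift e (const c)

opaque
  unfolding monomial

  monomial-coeff : ∀ e c n → monomial e c n ≡ (if n ℕ.≡ᵇ e then c else 0ℤ)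
  monomial-coeff zero    c zero    = refl
  monomial-coeff zero    c (suc n) = refl
  monomial-coeff (suc e) c zero    = refl
  monomial-coeff (suc e) c (suc n) = monomial-coeff e c n

  monomial-zero : ∀ c → monomial 0 c ≈ const c
  monomial-zero c = ≈-refl

  monomial≈[]𝟘 : ∀ e c → monomial e c ≈[ e ] 𝟘
  monomial≈[]𝟘 e c = mk≈[] λ n n<e → shift-below e (const c) n n<e

  monomial-⊗ : ∀ e c f → monomial e c ⊗ f ≈ shift e (λ n → c * f n)
  monomial-⊗ e c f = ≈-trans (shift-⊗ e (const c) f) (shift-cong e (const-⊗ c f))

  monomial-⊗-monomial : ∀ a b c d → monomial a c ⊗ monomial b d ≈ monomial (a ℕ.+ b) (c * d)
  monomial-⊗-monomial a b c d = ≈-trans (shift-⊗ a (const c) (monomial b d))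
    (≈-trans (shift-cong a (≈-trans (⊗-comm (const c) (monomial b d))
       (≈-trans (shift-⊗ b (const d) (const c)) (shift-cong b (≈-trans (⊗-comm (const d) (const c)) constant-product)))))
    (shift-shift a b (const (c * d))))
    where
    constant-product : const c ⊗ const d ≈ const (c * d)
    constant-product = ≈-trans (const-⊗ c (const d)) (mk≈ λ { zero → refl ; (suc n) → ℤ.*-zeroʳ c })

  monomial-⊗-≈[] : ∀ e c {f m} → f ≈[ m ] one → monomial e c ⊗ f ≈[ e ℕ.+ m ] monomial e c
  monomial-⊗-≈[] e c {f} f≈1 = ≈[]-trans (≈⇒≈[] (shift-⊗ e (const c) f))
    (shift-cong[] e (≈[]-trans (⊗-cong[] ≈[]-refl f≈1) (≈⇒≈[] (⊗-identityʳ (const c)))))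

monomial-≡ : ∀ {e e′ c c′} → e ≡ e′ → c ≡ c′ → monomial e c ≈ monomial e′ c′
monomial-≡ refl refl = ≈-refl

monomial-neg : ∀ e c → monomial e (- c) ≈ ⊖ monomial e c
monomial-neg e c = mk≈ λ n → trans (monomial-coeff e (- c) n)
  (trans (neg-if (n ℕ.≡ᵇ e)) (sym (trans (⊖-at _ n) (cong -_ (monomial-coeff e c n)))))
  where
  neg-if : ∀ b → (if b then - c else 0ℤ) ≡ - (if b then c else 0ℤ)
  neg-if true  = refl
  neg-if false = refl

1-q^ : ℕ → Series
1-q^ e = const 1ℤ ⊕ ⊖ monomial e 1ℤ

1-q^-≡ : ∀ {a b} → a ≡ b → 1-q^ a ≈ 1-q^ b
1-q^-≡ refl = ≈-refl

1-q^-coeff : ∀ e n → 1-q^ e n ≡ const 1ℤ n + - (if n ℕ.≡ᵇ e then 1ℤ else 0ℤ)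
1-q^-coeff e n = trans (⊕-at _ _ n) (cong (const 1ℤ n +_) (trans (⊖-at _ n) (cong -_ (monomial-coeff e 1ℤ n))))

oneMinusQ^≈1-q^ : ∀ k → oneMinusQ^ (suc k) ≈ 1-q^ (suc k)
oneMinusQ^≈1-q^ k = mk≈ λ n → sym (trans (1-q^-coeff (suc k) n) (go n))
  where
  go : ∀ n → const 1ℤ n + - (if n ℕ.≡ᵇ suc k then 1ℤ else 0ℤ) ≡ oneMinusQ^ (suc k) n
  go zero = refl
  go (suc n) with n ℕ.≡ᵇ k
  ... | true  = refl
  ... | false = refl

1-q^≈[]one : ∀ e → 1-q^ e ≈[ e ] one
1-q^≈[]one e = ≈[]-trans (⊕-cong[] ≈[]-refl (mk≈[] λ n n<e → trans (⊖-at _ n) (cong -_ (below q^e≈0 n n<e))))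
  (≈⇒≈[] (≈-trans (mk≈ λ n → trans (⊕-at _ 𝟘 n) (ℤ.+-identityʳ _)) (≈-sym one≈const1)))
  where
  q^e≈0 : monomial e 1ℤ ≈[ e ] 𝟘
  q^e≈0 = monomial≈[]𝟘 e 1ℤ

-- Subtracting from Σ_k q^{(j+1)k} its own shift by j + 1 leaves 1.
invOneMinusQ^suc-inverse : ∀ j → invOneMinusQ^suc j ⊗ 1-q^ (suc j) ≈ one
invOneMinusQ^suc-inverse j = ≈-trans (distrib I (monomial (suc j) 1ℤ))
  (≈-trans (⊕-congˡ (⊖-cong (≈-trans (⊗-comm I _) (monomial-⊗ (suc j) 1ℤ I))))
  (mk≈ λ n → trans (⊕-at I _ n) (trans (cong (I n +_) (⊖-at _ n)) (telescope n))))
  where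
  I : Series
  I = invOneMinusQ^suc j
  distrib : ∀ a b → a ⊗ (const 1ℤ ⊕ ⊖ b) ≈ a ⊕ ⊖ (a ⊗ b)
  distrib = solve 2 (λ a b → a :* (con 1ℤ :+ :- b) := a :+ :- (a :* b)) ≈-refl
  telescope : ∀ n → I n + - shift (suc j) (λ n → 1ℤ * I n) n ≡ one n
  telescope zero = refl
  telescope (suc m) with suc m ℕ.<? suc j
  ... | yes m<j rewrite shift-below (suc j) (λ n → 1ℤ * I n) (suc m) m<j | m<n⇒m%n≡m m<j = refl
  ... | no  m≮j rewrite shift-above (suc j) (λ n → 1ℤ * I n) (suc m) (ℕ.≮⇒≥ m≮j)
                      | ℤ.*-identityˡ (I (m ∸ j))
                      | m≤n⇒[n∸m]%m≡n%m (ℕ.≮⇒≥ m≮j) = ℤ.+-inverseʳ (I (suc m))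

invOneMinusQ^suc≈[]one : ∀ j → invOneMinusQ^suc j ≈[ suc j ] one
invOneMinusQ^suc≈[]one j = mk≈[] λ where
  zero    _     → refl
  (suc m) m<1+j → cong (λ r → if r ℕ.≡ᵇ 0 then 1ℤ else 0ℤ) (m<n⇒m%n≡m m<1+j)

sumSeries : ℕ → (ℕ → Series) → Series
sumSeries zero    F = F 0
sumSeries (suc n) F = sumSeries n F ⊕ F (suc n)

sumSeries-cong : ∀ n {F G : ℕ → Series} → (∀ j → F j ≈ G j) → sumSeries n F ≈ sumSeries n G
sumSeries-cong zero    F≈G = F≈G 0
sumSeries-cong (suc n) F≈G = ⊕-cong (sumSeries-cong n F≈G) (F≈G (suc n))

sumSeries-cong[] : ∀ n {F G : ℕ → Series} {m} → (∀ j → j ℕ.≤ n → F j ≈[ m ] G j) →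
                   sumSeries n F ≈[ m ] sumSeries n G
sumSeries-cong[] zero    F≈G = F≈G 0 z≤n
sumSeries-cong[] (suc n) F≈G =
  ⊕-cong[] (sumSeries-cong[] n (λ j j≤n → F≈G j (ℕ.m≤n⇒m≤1+n j≤n))) (F≈G (suc n) ℕ.≤-refl)

sumSeries-≡ : ∀ {a b} F → a ≡ b → sumSeries a F ≈ sumSeries b F
sumSeries-≡ F refl = ≈-refl

sumSeries-unfoldˡ : ∀ n F → sumSeries (suc n) F ≈ F 0 ⊕ sumSeries n (λ j → F (suc j))
sumSeries-unfoldˡ zero    F = ≈-refl
sumSeries-unfoldˡ (suc n) F = ≈-trans (⊕-congʳ (sumSeries-unfoldˡ n F)) (⊕-assoc (F 0) _ _)

⊗-sumSeries : ∀ n f F → f ⊗ sumSeries n F ≈ sumSeries n (λ j → f ⊗ F j)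
⊗-sumSeries zero    f F = ≈-refl
⊗-sumSeries (suc n) f F = ≈-trans (⊗-distribˡ-⊕ f (sumSeries n F) (F (suc n))) (⊕-congʳ (⊗-sumSeries n f F))

sumSeries-⊕ : ∀ n F G → sumSeries n (λ j → F j ⊕ G j) ≈ sumSeries n F ⊕ sumSeries n G
sumSeries-⊕ zero    F G = ≈-refl
sumSeries-⊕ (suc n) F G = ≈-trans (⊕-congʳ (sumSeries-⊕ n F G)) (interchange _ _ _ _)
  where
  interchange : ∀ a b c d → (a ⊕ b) ⊕ (c ⊕ d) ≈ (a ⊕ c) ⊕ (b ⊕ d)
  interchange = solve 4 (λ a b c d → (a :+ b) :+ (c :+ d) := (a :+ c) :+ (b :+ d)) ≈-refl

-- Gaussian binomial coefficients

Q^ : ℕ → Series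
Q^ e = monomial (2 ℕ.* e) 1ℤ

-- [N, j]_{q²}, by the q-Pascal rule
qBinom : ℕ → ℕ → Series
qBinom zero    zero    = one
qBinom zero    (suc j) = 𝟘
qBinom (suc N) zero    = one
qBinom (suc N) (suc j) = qBinom N j ⊕ Q^ (suc j) ⊗ qBinom N (suc j)

qBinom-≡ : ∀ {N N′} j → N ≡ N′ → qBinom N j ≈ qBinom N′ j
qBinom-≡ j refl = ≈-refl

qBinom-zero : ∀ N → qBinom N 0 ≈ one
qBinom-zero zero    = ≈-refl
qBinom-zero (suc N) = ≈-refl

qBinom-> : ∀ N j → N ℕ.< j → qBinom N j ≈ 𝟘
qBinom-> zero    (suc j) _         = ≈-refl
qBinom-> (suc N) (suc j) (s≤s N<j) = ≈-trans
  (⊕-cong (qBinom-> N j N<j) (≈-trans (⊗-congˡ (qBinom-> N (suc j) (ℕ.m<n⇒m<1+n N<j))) (⊗-zeroʳ _)))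
  (⊕-identityʳ 𝟘)

⊗-qBinom-top : ∀ N f → f ⊗ qBinom N (suc N) ≈ 𝟘
⊗-qBinom-top N f = ≈-trans (⊗-congˡ (qBinom-> N (suc N) ℕ.≤-refl)) (⊗-zeroʳ _)

-- The q-binomial theorem  Σ_j (-1)^j q^{j² + 2ij} [n, j]_{q²} = (q^{2i+1}; q²)_n

sign : ℕ → ℤ
sign zero    = 1ℤ
sign (suc k) = - sign k

oddProd : ℕ → ℕ → Series
oddProd zero    i = one
oddProd (suc n) i = 1-q^ (2 ℕ.* i ℕ.+ 1) ⊗ oddProd n (suc i)

oddProd-unfoldʳ : ∀ n i → oddProd (suc n) i ≈ oddProd n i ⊗ 1-q^ (2 ℕ.* (i ℕ.+ n) ℕ.+ 1)
oddProd-unfoldʳ zero    i = ≈-trans (⊗-comm _ _) (⊗-congˡ (1-q^-≡ (cong (λ k → 2 ℕ.* k ℕ.+ 1) (sym (ℕ.+-identityʳ i)))))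
oddProd-unfoldʳ (suc n) i = ≈-trans (⊗-congˡ (oddProd-unfoldʳ n (suc i)))
  (≈-trans (≈-sym (⊗-assoc _ _ _)) (⊗-congˡ (1-q^-≡ (cong (λ k → 2 ℕ.* k ℕ.+ 1) (sym (ℕ.+-suc i n))))))

cauchyTerm : ℕ → ℕ → Series
cauchyTerm i j = monomial (j ℕ.* j ℕ.+ 2 ℕ.* (i ℕ.* j)) (sign j)

cauchySum : ℕ → ℕ → Series
cauchySum n i = sumSeries n (λ j → cauchyTerm i j ⊗ qBinom n j)

cauchyTerm-zero : ∀ i → cauchyTerm i 0 ≈ one
cauchyTerm-zero i = ≈-trans (monomial-≡ (cong (2 ℕ.*_) (ℕ.*-zeroʳ i)) refl) (≈-trans (monomial-zero 1ℤ) (≈-sym one≈const1))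

cauchyTerm-suc : ∀ i j → cauchyTerm i (suc j) ≈ ⊖ (monomial (2 ℕ.* i ℕ.+ 1) 1ℤ ⊗ cauchyTerm (suc i) j)
cauchyTerm-suc i j = ≈-trans (monomial-≡ (exponent i j) (cong -_ (sym (ℤ.*-identityˡ (sign j)))))
  (≈-trans (monomial-neg _ _) (⊖-cong (≈-sym (monomial-⊗-monomial _ _ 1ℤ (sign j)))))
  where
  exponent : ∀ i j → suc j ℕ.* suc j ℕ.+ 2 ℕ.* (i ℕ.* suc j)
                   ≡ 2 ℕ.* i ℕ.+ 1 ℕ.+ (j ℕ.* j ℕ.+ 2 ℕ.* (suc i ℕ.* j))
  exponent = ℕ-solve-∀

cauchyTerm-⊗-Q^ : ∀ i j → cauchyTerm i (suc j) ⊗ Q^ (suc j) ≈ cauchyTerm (suc i) (suc j)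
cauchyTerm-⊗-Q^ i j = ≈-trans (monomial-⊗-monomial _ _ _ _) (monomial-≡ (exponent i j) (ℤ.*-identityʳ _))
  where
  exponent : ∀ i j → suc j ℕ.* suc j ℕ.+ 2 ℕ.* (i ℕ.* suc j) ℕ.+ 2 ℕ.* suc j
                   ≡ suc j ℕ.* suc j ℕ.+ 2 ℕ.* (suc i ℕ.* suc j)
  exponent = ℕ-solve-∀

-- After Pascal's rule one half is -q^{2i+1} cauchySum n (i + 1); the other, together with the
-- term j = 0, is cauchySum n (i + 1).
cauchySum-suc : ∀ n i → cauchySum (suc n) i ≈ 1-q^ (2 ℕ.* i ℕ.+ 1) ⊗ cauchySum n (suc i)
cauchySum-suc n i = begin
    sumSeries (suc n) (λ j → cauchyTerm i j ⊗ qBinom (suc n) j)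
  ≈⟨ sumSeries-unfoldˡ n _ ⟩
    cauchyTerm i 0 ⊗ one ⊕ sumSeries n (λ j → cauchyTerm i (suc j) ⊗ (qBinom n j ⊕ Q^ (suc j) ⊗ qBinom n (suc j)))
  ≈⟨ ⊕-congˡ (sumSeries-cong n split) ⟩
    cauchyTerm i 0 ⊗ one ⊕ sumSeries n (λ j → ⊖ M ⊗ (cauchyTerm (suc i) j ⊗ qBinom n j)
                                              ⊕ cauchyTerm (suc i) (suc j) ⊗ qBinom n (suc j))
  ≈⟨ ⊕-congˡ (sumSeries-⊕ n _ _) ⟩
    cauchyTerm i 0 ⊗ one ⊕ (sumSeries n (λ j → ⊖ M ⊗ (cauchyTerm (suc i) j ⊗ qBinom n j)) ⊕ R)
  ≈⟨ ⊕-congˡ (⊕-congʳ (⊗-sumSeries n (⊖ M) (λ j → cauchyTerm (suc i) j ⊗ qBinom n j))) ⟨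
    cauchyTerm i 0 ⊗ one ⊕ (⊖ M ⊗ B ⊕ R)
  ≈⟨ rotate (cauchyTerm i 0 ⊗ one) (⊖ M ⊗ B) R ⟩
    ⊖ M ⊗ B ⊕ (cauchyTerm i 0 ⊗ one ⊕ R)
  ≈⟨ ⊕-congˡ recombine ⟩
    ⊖ M ⊗ B ⊕ B
  ≈⟨ factor M B ⟨
    1-q^ (2 ℕ.* i ℕ.+ 1) ⊗ B ∎
  where
  open SeriesReasoning
  M B R : Series
  M = monomial (2 ℕ.* i ℕ.+ 1) 1ℤ
  B = cauchySum n (suc i)
  R = sumSeries n (λ j → cauchyTerm (suc i) (suc j) ⊗ qBinom n (suc j))
  distrib : ∀ a x y z → a ⊗ (x ⊕ y ⊗ z) ≈ a ⊗ x ⊕ (a ⊗ y) ⊗ z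
  distrib = solve 4 (λ a x y z → a :* (x :+ y :* z) := a :* x :+ (a :* y) :* z) ≈-refl
  neg-assoc : ∀ a b c → ⊖ (a ⊗ b) ⊗ c ≈ ⊖ a ⊗ (b ⊗ c)
  neg-assoc = solve 3 (λ a b c → :- (a :* b) :* c := :- a :* (b :* c)) ≈-refl
  rotate : ∀ a b c → a ⊕ (b ⊕ c) ≈ b ⊕ (a ⊕ c)
  rotate = solve 3 (λ a b c → a :+ (b :+ c) := b :+ (a :+ c)) ≈-refl
  factor : ∀ a b → (const 1ℤ ⊕ ⊖ a) ⊗ b ≈ ⊖ a ⊗ b ⊕ b
  factor = solve 2 (λ a b → (con 1ℤ :+ :- a) :* b := :- a :* b :+ b) ≈-refl
  split : ∀ j → cauchyTerm i (suc j) ⊗ (qBinom n j ⊕ Q^ (suc j) ⊗ qBinom n (suc j))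
              ≈ ⊖ M ⊗ (cauchyTerm (suc i) j ⊗ qBinom n j) ⊕ cauchyTerm (suc i) (suc j) ⊗ qBinom n (suc j)
  split j = ≈-trans (distrib (cauchyTerm i (suc j)) (qBinom n j) (Q^ (suc j)) (qBinom n (suc j)))
    (⊕-cong (≈-trans (⊗-congʳ (cauchyTerm-suc i j)) (neg-assoc M (cauchyTerm (suc i) j) (qBinom n j)))
            (⊗-congʳ (cauchyTerm-⊗-Q^ i j)))
  recombine : cauchyTerm i 0 ⊗ one ⊕ R ≈ B
  recombine = ≈-sym (begin
      B
    ≈⟨ ⊕-identityʳ B ⟨
      B ⊕ 𝟘
    ≈⟨ ⊕-congˡ (⊗-qBinom-top n _) ⟨
      sumSeries (suc n) (λ j → cauchyTerm (suc i) j ⊗ qBinom n j)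
    ≈⟨ sumSeries-unfoldˡ n _ ⟩
      cauchyTerm (suc i) 0 ⊗ qBinom n 0 ⊕ R
    ≈⟨ ⊕-congʳ (⊗-cong (≈-trans (cauchyTerm-zero (suc i)) (≈-sym (cauchyTerm-zero i))) (qBinom-zero n)) ⟩
      cauchyTerm i 0 ⊗ one ⊕ R ∎)

q-binomial : ∀ n i → cauchySum n i ≈ oddProd n i
q-binomial zero    i = ≈-trans (⊗-congʳ (cauchyTerm-zero i)) (⊗-identityˡ one)
q-binomial (suc n) i = ≈-trans (cauchySum-suc n i) (⊗-congˡ (q-binomial n (suc i)))

-- A finite Jacobi triple product
--   Σ_{j ≤ m+n} (-1)^{j+m} q^{(j-m)²} [m+n, j]_{q²} = (q; q²)_m (q; q²)_n

square : ℕ → ℕ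
square k = k ℕ.* k

distance-square-suc : ∀ j m → square ∣ j - suc m ∣ ℕ.+ 2 ℕ.* j ≡ (2 ℕ.* m ℕ.+ 1) ℕ.+ square ∣ j - m ∣
distance-square-suc zero    m       = lemma m
  where
  lemma : ∀ m → suc m ℕ.* suc m ℕ.+ 2 ℕ.* 0 ≡ (2 ℕ.* m ℕ.+ 1) ℕ.+ m ℕ.* m
  lemma = ℕ-solve-∀
distance-square-suc (suc j) zero    rewrite ℕ.∣-∣-identityʳ j = lemma j
  where
  lemma : ∀ j → j ℕ.* j ℕ.+ 2 ℕ.* suc j ≡ (2 ℕ.* 0 ℕ.+ 1) ℕ.+ suc j ℕ.* suc j
  lemma = ℕ-solve-∀
distance-square-suc (suc j) (suc m) = begin
  square ∣ j - suc m ∣ ℕ.+ 2 ℕ.* suc j          ≡⟨ lemma₁ (square ∣ j - suc m ∣) j ⟩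
  square ∣ j - suc m ∣ ℕ.+ 2 ℕ.* j ℕ.+ 2        ≡⟨ cong (ℕ._+ 2) (distance-square-suc j m) ⟩
  (2 ℕ.* m ℕ.+ 1) ℕ.+ square ∣ j - m ∣ ℕ.+ 2    ≡⟨ lemma₂ m (square ∣ j - m ∣) ⟩
  (2 ℕ.* suc m ℕ.+ 1) ℕ.+ square ∣ j - m ∣      ∎
  where
  open ≡-Reasoning
  lemma₁ : ∀ a j → a ℕ.+ 2 ℕ.* suc j ≡ a ℕ.+ 2 ℕ.* j ℕ.+ 2
  lemma₁ = ℕ-solve-∀
  lemma₂ : ∀ m b → (2 ℕ.* m ℕ.+ 1) ℕ.+ b ℕ.+ 2 ≡ (2 ℕ.* suc m ℕ.+ 1) ℕ.+ b
  lemma₂ = ℕ-solve-∀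

thetaTerm : ℕ → ℕ → Series
thetaTerm j m = monomial (square ∣ j - m ∣) (sign (j ℕ.+ m))

thetaTerm-suc-suc : ∀ j m → thetaTerm (suc j) (suc m) ≈ thetaTerm j m
thetaTerm-suc-suc j m = monomial-≡ refl (trans (cong (λ k → - sign k) (ℕ.+-suc j m)) (ℤ.neg-involutive (sign (j ℕ.+ m))))

thetaTerm-⊗-Q^ : ∀ j m → thetaTerm j (suc m) ⊗ Q^ j ≈ ⊖ (monomial (2 ℕ.* m ℕ.+ 1) 1ℤ ⊗ thetaTerm j m)
thetaTerm-⊗-Q^ j m = begin
    thetaTerm j (suc m) ⊗ Q^ j
  ≈⟨ monomial-⊗-monomial (square ∣ j - suc m ∣) (2 ℕ.* j) (sign (j ℕ.+ suc m)) 1ℤ ⟩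
    monomial (square ∣ j - suc m ∣ ℕ.+ 2 ℕ.* j) (sign (j ℕ.+ suc m) * 1ℤ)
  ≈⟨ monomial-≡ (distance-square-suc j m) sign-eq ⟩
    monomial (2 ℕ.* m ℕ.+ 1 ℕ.+ square ∣ j - m ∣) (- (1ℤ * sign (j ℕ.+ m)))
  ≈⟨ monomial-neg _ _ ⟩
    ⊖ monomial (2 ℕ.* m ℕ.+ 1 ℕ.+ square ∣ j - m ∣) (1ℤ * sign (j ℕ.+ m))
  ≈⟨ ⊖-cong (monomial-⊗-monomial (2 ℕ.* m ℕ.+ 1) (square ∣ j - m ∣) 1ℤ (sign (j ℕ.+ m))) ⟨
    ⊖ (monomial (2 ℕ.* m ℕ.+ 1) 1ℤ ⊗ thetaTerm j m) ∎
  where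
  open SeriesReasoning
  sign-eq : sign (j ℕ.+ suc m) * 1ℤ ≡ - (1ℤ * sign (j ℕ.+ m))
  sign-eq = trans (ℤ.*-identityʳ _) (trans (cong sign (ℕ.+-suc j m)) (cong -_ (sym (ℤ.*-identityˡ _))))

jacobiSum : ℕ → ℕ → Series
jacobiSum m n = sumSeries (m ℕ.+ n) (λ j → thetaTerm j m ⊗ qBinom (m ℕ.+ n) j)

-- After Pascal's rule one half is jacobiSum m n itself, the other -q^{2m+1} jacobiSum m n.
jacobiSum-suc : ∀ m n → jacobiSum (suc m) n ≈ 1-q^ (2 ℕ.* m ℕ.+ 1) ⊗ jacobiSum m n
jacobiSum-suc m n = begin
    sumSeries (suc K) (λ j → thetaTerm j (suc m) ⊗ qBinom (suc K) j)
  ≈⟨ sumSeries-unfoldˡ K _ ⟩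
    thetaTerm 0 (suc m) ⊗ one ⊕ sumSeries K (λ j → thetaTerm (suc j) (suc m) ⊗ (qBinom K j ⊕ Q^ (suc j) ⊗ qBinom K (suc j)))
  ≈⟨ ⊕-congˡ (sumSeries-cong K split) ⟩
    thetaTerm 0 (suc m) ⊗ one ⊕ sumSeries K (λ j → thetaTerm j m ⊗ qBinom K j
                                                   ⊕ (thetaTerm (suc j) (suc m) ⊗ Q^ (suc j)) ⊗ qBinom K (suc j))
  ≈⟨ ⊕-congˡ (sumSeries-⊕ K _ _) ⟩
    thetaTerm 0 (suc m) ⊗ one ⊕ (S ⊕ R)
  ≈⟨ ≈-trans (⊕-congʳ top) (rotate (T 0) S R) ⟩
    S ⊕ (T 0 ⊕ R)
  ≈⟨ ⊕-congˡ (sumSeries-unfoldˡ K T) ⟨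
    S ⊕ sumSeries (suc K) T
  ≈⟨ ⊕-congˡ (sumSeries-cong (suc K) shifted) ⟩
    S ⊕ sumSeries (suc K) (λ j → ⊖ M ⊗ (thetaTerm j m ⊗ qBinom K j))
  ≈⟨ ⊕-congˡ (⊗-sumSeries (suc K) (⊖ M) (λ j → thetaTerm j m ⊗ qBinom K j)) ⟨
    S ⊕ ⊖ M ⊗ (S ⊕ thetaTerm (suc K) m ⊗ qBinom K (suc K))
  ≈⟨ ⊕-congˡ (⊗-congˡ (≈-trans (⊕-congˡ (⊗-qBinom-top K _)) (⊕-identityʳ S))) ⟩
    S ⊕ ⊖ M ⊗ S
  ≈⟨ factor M S ⟨
    1-q^ (2 ℕ.* m ℕ.+ 1) ⊗ S ∎
  where
  open SeriesReasoning
  K : ℕ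
  K = m ℕ.+ n
  M S : Series
  M = monomial (2 ℕ.* m ℕ.+ 1) 1ℤ
  S = jacobiSum m n
  T : ℕ → Series
  T j = thetaTerm j (suc m) ⊗ Q^ j ⊗ qBinom K j
  R : Series
  R = sumSeries K (λ j → T (suc j))
  distrib : ∀ a b x y z → a ⊗ (x ⊕ y ⊗ z) ≈ b ⊗ x ⊕ (a ⊗ y) ⊗ z ⊕ (a ⊕ ⊖ b) ⊗ x
  distrib = solve 5 (λ a b x y z → a :* (x :+ y :* z) := b :* x :+ (a :* y) :* z :+ (a :+ :- b) :* x) ≈-refl
  split : ∀ j → thetaTerm (suc j) (suc m) ⊗ (qBinom K j ⊕ Q^ (suc j) ⊗ qBinom K (suc j))
              ≈ thetaTerm j m ⊗ qBinom K j ⊕ (thetaTerm (suc j) (suc m) ⊗ Q^ (suc j)) ⊗ qBinom K (suc j)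
  split j = ≈-trans (distrib (thetaTerm (suc j) (suc m)) (thetaTerm j m) (qBinom K j) (Q^ (suc j)) (qBinom K (suc j)))
    (≈-trans (⊕-congˡ (≈-trans (⊗-congʳ (≈-trans (⊕-congʳ (thetaTerm-suc-suc j m)) (⊕-inverseʳ _)))
                               (≈-trans (⊗-comm 𝟘 _) (⊗-zeroʳ _))))
             (⊕-identityʳ _))
  top : thetaTerm 0 (suc m) ⊗ one ≈ T 0
  top = ≈-sym (≈-trans (⊗-congˡ (qBinom-zero K))
          (≈-trans (⊗-identityʳ _) (⊗-congˡ (≈-trans (monomial-zero 1ℤ) (≈-sym one≈const1)))))
  rotate : ∀ a b c → a ⊕ (b ⊕ c) ≈ b ⊕ (a ⊕ c)
  rotate = solve 3 (λ a b c → a :+ (b :+ c) := b :+ (a :+ c)) ≈-refl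
  neg-assoc : ∀ a b c → ⊖ (a ⊗ b) ⊗ c ≈ ⊖ a ⊗ (b ⊗ c)
  neg-assoc = solve 3 (λ a b c → :- (a :* b) :* c := :- a :* (b :* c)) ≈-refl
  shifted : ∀ j → T j ≈ ⊖ M ⊗ (thetaTerm j m ⊗ qBinom K j)
  shifted j = ≈-trans (⊗-congʳ (thetaTerm-⊗-Q^ j m)) (neg-assoc M (thetaTerm j m) (qBinom K j))
  factor : ∀ a b → (const 1ℤ ⊕ ⊖ a) ⊗ b ≈ b ⊕ ⊖ a ⊗ b
  factor = solve 2 (λ a b → (con 1ℤ :+ :- a) :* b := b :+ :- a :* b) ≈-refl

jacobiSum-zero : ∀ n → jacobiSum 0 n ≈ cauchySum n 0
jacobiSum-zero n = sumSeries-cong n λ j → ⊗-congʳ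
  (monomial-≡ (trans (cong square (ℕ.∣-∣-identityʳ j)) (sym (ℕ.+-identityʳ (square j))))
              (cong sign (ℕ.+-identityʳ j)))

jacobi-triple-product : ∀ m n → jacobiSum m n ≈ oddProd m 0 ⊗ oddProd n 0
jacobi-triple-product zero    n = ≈-trans (jacobiSum-zero n) (≈-trans (q-binomial n 0) (≈-sym (⊗-identityˡ _)))
jacobi-triple-product (suc m) n = ≈-trans (jacobiSum-suc m n)
  (≈-trans (⊗-congˡ (jacobi-triple-product m n))
  (≈-trans (≈-sym (⊗-assoc _ _ _))
  (⊗-congʳ (≈-trans (⊗-comm _ _) (≈-sym (oddProd-unfoldʳ m 0))))))

evenProd : ℕ → ℕ → Series
evenProd b zero    = one
evenProd b (suc a) = 1-q^ (2 ℕ.* suc b) ⊗ evenProd (suc b) a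

evenProd-≡ : ∀ {b b′} a → b ≡ b′ → evenProd b a ≈ evenProd b′ a
evenProd-≡ a refl = ≈-refl

evenProd-unfoldʳ : ∀ b a → evenProd b (suc a) ≈ evenProd b a ⊗ 1-q^ (2 ℕ.* (b ℕ.+ suc a))
evenProd-unfoldʳ b zero    = ≈-trans (⊗-comm _ _)
  (⊗-congˡ (1-q^-≡ (cong (2 ℕ.*_) (trans (cong suc (sym (ℕ.+-identityʳ b))) (sym (ℕ.+-suc b 0))))))
evenProd-unfoldʳ b (suc a) = ≈-trans (⊗-congˡ (evenProd-unfoldʳ (suc b) a))
  (≈-trans (≈-sym (⊗-assoc _ _ _)) (⊗-congˡ (1-q^-≡ (cong (2 ℕ.*_) (sym (ℕ.+-suc b (suc a)))))))

evenProd-+ : ∀ b a e → evenProd b (a ℕ.+ e) ≈ evenProd b a ⊗ evenProd (b ℕ.+ a) e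
evenProd-+ b zero    e = ≈-trans (evenProd-≡ e (sym (ℕ.+-identityʳ b))) (≈-sym (⊗-identityˡ _))
evenProd-+ b (suc a) e = ≈-trans (⊗-congˡ (evenProd-+ (suc b) a e))
  (≈-trans (≈-sym (⊗-assoc _ _ _)) (⊗-congˡ (evenProd-≡ e (sym (ℕ.+-suc b a)))))

evenProd≈[]one : ∀ b a → evenProd b a ≈[ 2 ℕ.* suc b ] one
evenProd≈[]one b zero    = ≈[]-refl
evenProd≈[]one b (suc a) = ⊗-one[] (1-q^≈[]one (2 ℕ.* suc b))
  (≈[]-weaken (ℕ.*-monoʳ-≤ 2 (ℕ.n≤1+n (suc b))) (evenProd≈[]one (suc b) a))

qBinom-⊗-evenProd : ∀ a b → qBinom (a ℕ.+ b) a ⊗ evenProd 0 a ≈ evenProd b a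
qBinom-⊗-evenProd zero    b = ≈-trans (⊗-congʳ (qBinom-zero b)) (⊗-identityˡ one)
qBinom-⊗-evenProd (suc a) zero = begin
    (qBinom (a ℕ.+ 0) a ⊕ Q^ (suc a) ⊗ qBinom (a ℕ.+ 0) (suc a)) ⊗ evenProd 0 (suc a)
  ≈⟨ ⊗-congʳ (⊕-congˡ (≈-trans (⊗-congˡ (qBinom-> (a ℕ.+ 0) (suc a) (s≤s (ℕ.≤-reflexive (ℕ.+-identityʳ a)))))
                                 (⊗-zeroʳ _))) ⟩
    (qBinom (a ℕ.+ 0) a ⊕ 𝟘) ⊗ evenProd 0 (suc a)
  ≈⟨ ⊗-congʳ (⊕-identityʳ _) ⟩
    qBinom (a ℕ.+ 0) a ⊗ evenProd 0 (suc a)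
  ≈⟨ ⊗-congˡ (evenProd-unfoldʳ 0 a) ⟩
    qBinom (a ℕ.+ 0) a ⊗ (evenProd 0 a ⊗ 1-q^ (2 ℕ.* suc a))
  ≈⟨ ⊗-assoc _ _ _ ⟨
    (qBinom (a ℕ.+ 0) a ⊗ evenProd 0 a) ⊗ 1-q^ (2 ℕ.* suc a)
  ≈⟨ ⊗-congʳ (qBinom-⊗-evenProd a 0) ⟩
    evenProd 0 a ⊗ 1-q^ (2 ℕ.* suc a)
  ≈⟨ evenProd-unfoldʳ 0 a ⟨
    evenProd 0 (suc a) ∎
  where open SeriesReasoning
qBinom-⊗-evenProd (suc a) (suc b) = begin
    (qBinom (a ℕ.+ suc b) a ⊕ Q^ (suc a) ⊗ qBinom (a ℕ.+ suc b) (suc a)) ⊗ evenProd 0 (suc a)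
  ≈⟨ ⊗-distribʳ-⊕ _ _ _ ⟩
    qBinom (a ℕ.+ suc b) a ⊗ evenProd 0 (suc a) ⊕ (Q^ (suc a) ⊗ qBinom (a ℕ.+ suc b) (suc a)) ⊗ evenProd 0 (suc a)
  ≈⟨ ⊕-cong (≈-trans (⊗-congˡ (evenProd-unfoldʳ 0 a))
                     (≈-trans (≈-sym (⊗-assoc _ _ _)) (⊗-congʳ (qBinom-⊗-evenProd a (suc b)))))
            (≈-trans (⊗-assoc _ _ _)
                     (⊗-congˡ (≈-trans (⊗-congʳ (qBinom-≡ (suc a) (ℕ.+-suc a b))) (qBinom-⊗-evenProd (suc a) b)))) ⟩
    evenProd (suc b) a ⊗ 1-q^ (2 ℕ.* suc a) ⊕ Q^ (suc a) ⊗ (1-q^ (2 ℕ.* suc b) ⊗ evenProd (suc b) a)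
  ≈⟨ combine (evenProd (suc b) a) (Q^ (suc a)) (Q^ (suc b)) ⟩
    evenProd (suc b) a ⊗ (const 1ℤ ⊕ ⊖ (Q^ (suc a) ⊗ Q^ (suc b)))
  ≈⟨ ⊗-congˡ (⊕-congˡ (⊖-cong (≈-trans (monomial-⊗-monomial _ _ _ _) (monomial-≡ (exponent a b) refl)))) ⟩
    evenProd (suc b) a ⊗ 1-q^ (2 ℕ.* (suc b ℕ.+ suc a))
  ≈⟨ evenProd-unfoldʳ (suc b) a ⟨
    evenProd (suc b) (suc a) ∎
  where
  open SeriesReasoning
  combine : ∀ x y z → x ⊗ (const 1ℤ ⊕ ⊖ y) ⊕ y ⊗ ((const 1ℤ ⊕ ⊖ z) ⊗ x) ≈ x ⊗ (const 1ℤ ⊕ ⊖ (y ⊗ z))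
  combine = solve 3 (λ x y z → x :* (con 1ℤ :+ :- y) :+ y :* ((con 1ℤ :+ :- z) :* x) := x :* (con 1ℤ :+ :- (y :* z))) ≈-refl
  exponent : ∀ a b → 2 ℕ.* suc a ℕ.+ 2 ℕ.* suc b ≡ 2 ℕ.* (suc b ℕ.+ suc a)
  exponent = ℕ-solve-∀

n≤square : ∀ n → n ℕ.≤ square n
n≤square zero    = z≤n
n≤square (suc n) = ℕ.m≤m*n (suc n) (suc n)

exponent-bound : ∀ a k → a ℕ.+ k ℕ.+ 1 ℕ.≤ square k ℕ.+ 2 ℕ.* suc a
exponent-bound a k = begin
  a ℕ.+ k ℕ.+ 1                       ≡⟨ lemma₁ a k ⟩
  k ℕ.+ suc a                         ≤⟨ ℕ.+-monoˡ-≤ (suc a) (n≤square k) ⟩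
  square k ℕ.+ suc a                  ≤⟨ ℕ.m≤m+n (square k ℕ.+ suc a) (suc a) ⟩
  square k ℕ.+ suc a ℕ.+ suc a        ≡⟨ lemma₂ (square k) a ⟩
  square k ℕ.+ 2 ℕ.* suc a            ∎
  where
  open ℕ.≤-Reasoning
  lemma₁ : ∀ a k → a ℕ.+ k ℕ.+ 1 ≡ k ℕ.+ suc a
  lemma₁ = ℕ-solve-∀
  lemma₂ : ∀ s a → s ℕ.+ suc a ℕ.+ suc a ≡ s ℕ.+ 2 ℕ.* suc a
  lemma₂ = ℕ-solve-∀

-- Multiplied by (q²; q²)_M, [2M, j]_{q²} becomes a product ≡ 1 (mod q^{2(M - |j - M|) + 2}),
-- which the factor q^{(j - M)²} of thetaTerm j M pushes beyond q^M.
TermTruncates : ℕ → ℕ → Set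
TermTruncates M j = thetaTerm j M ⊗ (qBinom (M ℕ.+ M) j ⊗ evenProd 0 M) ≈[ suc M ] thetaTerm j M

termTruncates-≤ : ∀ j k → TermTruncates (j ℕ.+ k) j
termTruncates-≤ j k = ≈[]-weaken bound (monomial-⊗-≈[] _ _ Y≈[]one)
  where
  M b : ℕ
  M = j ℕ.+ k
  b = j ℕ.+ (k ℕ.+ k)
  bound : suc M ℕ.≤ square ∣ j - M ∣ ℕ.+ 2 ℕ.* suc j
  bound = subst (λ d → suc M ℕ.≤ square d ℕ.+ 2 ℕ.* suc j) (sym (ℕ.∣m-m+n∣≡n j k))
    (subst (ℕ._≤ square k ℕ.+ 2 ℕ.* suc j) (ℕ.+-comm M 1) (exponent-bound j k))
  M+M≡j+b : M ℕ.+ M ≡ j ℕ.+ b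
  M+M≡j+b = lemma j k
    where
    lemma : ∀ j k → j ℕ.+ k ℕ.+ (j ℕ.+ k) ≡ j ℕ.+ (j ℕ.+ (k ℕ.+ k))
    lemma = ℕ-solve-∀
  Y≈[]one : qBinom (M ℕ.+ M) j ⊗ evenProd 0 M ≈[ 2 ℕ.* suc j ] one
  Y≈[]one = ≈[]-trans
    (≈⇒≈[] (≈-trans (⊗-cong (qBinom-≡ j M+M≡j+b) (evenProd-+ 0 j k))
           (≈-trans (≈-sym (⊗-assoc _ _ _)) (⊗-congʳ (qBinom-⊗-evenProd j b)))))
    (⊗-one[] (≈[]-weaken (ℕ.*-monoʳ-≤ 2 (s≤s (ℕ.m≤m+n j (k ℕ.+ k)))) (evenProd≈[]one b j)) (evenProd≈[]one j k))

termTruncates-≥ : ∀ b t → TermTruncates (b ℕ.+ t) (b ℕ.+ t ℕ.+ t)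
termTruncates-≥ b t = ≈[]-weaken bound (monomial-⊗-≈[] _ _ Y≈[]one)
  where
  M j : ℕ
  M = b ℕ.+ t
  j = M ℕ.+ t
  Y : Series
  Y = qBinom (M ℕ.+ M) j ⊗ evenProd 0 M
  bound : suc M ℕ.≤ square ∣ j - M ∣ ℕ.+ 2 ℕ.* suc b
  bound = subst (λ d → suc M ℕ.≤ square d ℕ.+ 2 ℕ.* suc b) (sym (trans (ℕ.∣-∣-comm j M) (ℕ.∣m-m+n∣≡n M t)))
    (subst (ℕ._≤ square t ℕ.+ 2 ℕ.* suc b) (ℕ.+-comm M 1) (exponent-bound b t))
  M+M≡j+b : M ℕ.+ M ≡ j ℕ.+ b
  M+M≡j+b = lemma b t
    where
    lemma : ∀ b t → b ℕ.+ t ℕ.+ (b ℕ.+ t) ≡ b ℕ.+ t ℕ.+ t ℕ.+ b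
    lemma = ℕ-solve-∀
  completed : Y ⊗ evenProd M t ≈ evenProd b j
  completed = ≈-trans (⊗-assoc _ _ _) (≈-trans (⊗-congˡ (≈-sym (evenProd-+ 0 M t)))
    (≈-trans (⊗-congʳ (qBinom-≡ j M+M≡j+b)) (qBinom-⊗-evenProd j b)))
  Y≈[]one : Y ≈[ 2 ℕ.* suc b ] one
  Y≈[]one = ≈[]-trans
    (≈[]-weaken (ℕ.*-monoʳ-≤ 2 (s≤s (ℕ.m≤m+n b t)))
      (≈[]-sym (≈[]-trans (⊗-cong[] ≈[]-refl (evenProd≈[]one M t)) (≈⇒≈[] (⊗-identityʳ Y)))))
    (≈[]-trans (≈⇒≈[] completed) (evenProd≈[]one b j))

termTruncates : ∀ M j → j ℕ.≤ M ℕ.+ M → TermTruncates M j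
termTruncates M j j≤2M with ℕ.≤-total j M
... | inj₁ j≤M = subst (λ M → TermTruncates M j) (ℕ.m+[n∸m]≡n j≤M) (termTruncates-≤ j (M ∸ j))
... | inj₂ M≤j = subst₂ TermTruncates M≡b+t j≡b+t+t (termTruncates-≥ (M ∸ t) t)
  where
  t : ℕ
  t = j ∸ M
  t≤M : t ℕ.≤ M
  t≤M = subst (t ℕ.≤_) (ℕ.m+n∸m≡n M M) (ℕ.∸-monoˡ-≤ M j≤2M)
  M≡b+t : M ∸ t ℕ.+ t ≡ M
  M≡b+t = ℕ.m∸n+n≡m t≤M
  j≡b+t+t : M ∸ t ℕ.+ t ℕ.+ t ≡ j
  j≡b+t+t = trans (cong (ℕ._+ t) M≡b+t) (ℕ.m+[n∸m]≡n M≤j)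

thetaSum : ℕ → Series
thetaSum M = sumSeries (M ℕ.+ M) (λ j → thetaTerm j M)

jacobiSum-⊗-evenProd≈[] : ∀ M → jacobiSum M M ⊗ evenProd 0 M ≈[ suc M ] thetaSum M
jacobiSum-⊗-evenProd≈[] M = ≈[]-trans
  (≈⇒≈[] (≈-trans (⊗-comm _ _) (≈-trans (⊗-sumSeries (M ℕ.+ M) (evenProd 0 M) _)
    (sumSeries-cong (M ℕ.+ M) (λ j → rearrange (evenProd 0 M) (thetaTerm j M) (qBinom (M ℕ.+ M) j))))))
  (sumSeries-cong[] (M ℕ.+ M) (termTruncates M))
  where
  rearrange : ∀ r a b → r ⊗ (a ⊗ b) ≈ a ⊗ (b ⊗ r)
  rearrange = solve 3 (λ r a b → r :* (a :* b) := a :* (b :* r)) ≈-refl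

-- φ(-q) = Σ_{k ∈ ℤ} (-1)^k q^{k²} = 1 + 2 Σ_{k ≥ 1} (-1)^k q^{k²}

sign-double-+ : ∀ a b → sign (a ℕ.+ a ℕ.+ b) ≡ sign b
sign-double-+ zero    b = refl
sign-double-+ (suc a) b = trans (cong sign (lemma a b)) (trans (ℤ.neg-involutive _) (sign-double-+ a b))
  where
  lemma : ∀ a b → suc a ℕ.+ suc a ℕ.+ b ≡ suc (suc (a ℕ.+ a ℕ.+ b))
  lemma = ℕ-solve-∀

halfThetaTerm : ℕ → Series
halfThetaTerm k = monomial (square (suc k)) (sign (suc k))

halfThetaTo : ℕ → Series
halfThetaTo zero    = 𝟘
halfThetaTo (suc M) = halfThetaTo M ⊕ halfThetaTerm M

halfTheta : Series
halfTheta n = halfThetaTo n n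

theta : Series
theta = one ⊕ halfTheta ⊕ halfTheta

thetaSum-suc : ∀ M → thetaSum (suc M) ≈ halfThetaTerm M ⊕ thetaSum M ⊕ halfThetaTerm M
thetaSum-suc M = ≈-trans (sumSeries-unfoldˡ (M ℕ.+ suc M) _)
  (≈-trans (⊕-congˡ (≈-trans (sumSeries-≡ (λ j → thetaTerm (suc j) (suc M)) (ℕ.+-suc M M))
     (⊕-cong (sumSeries-cong (M ℕ.+ M) (λ j → thetaTerm-suc-suc j M)) last)))
  (≈-sym (⊕-assoc _ _ _)))
  where
  last : thetaTerm (suc (suc (M ℕ.+ M))) (suc M) ≈ halfThetaTerm M
  last = monomial-≡ (cong square (trans (ℕ.∣-∣-comm (suc (suc (M ℕ.+ M))) (suc M))
                                   (trans (cong (λ x → ∣ M - x ∣) (sym (ℕ.+-suc M M))) (ℕ.∣m-m+n∣≡n M (suc M)))))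
                    (trans (cong sign (lemma M)) (sign-double-+ (suc M) (suc M)))
    where
    lemma : ∀ M → suc (suc (M ℕ.+ M)) ℕ.+ suc M ≡ suc M ℕ.+ suc M ℕ.+ suc M
    lemma = ℕ-solve-∀

thetaSum≈halfThetaTo : ∀ M → thetaSum M ≈ one ⊕ halfThetaTo M ⊕ halfThetaTo M
thetaSum≈halfThetaTo zero    = ≈-trans (≈-trans (monomial-zero 1ℤ) (≈-sym one≈const1))
  (≈-sym (≈-trans (⊕-assoc _ _ _) (≈-trans (⊕-congˡ (⊕-identityʳ 𝟘)) (⊕-identityʳ one))))
thetaSum≈halfThetaTo (suc M) = ≈-trans (thetaSum-suc M)
  (≈-trans (⊕-congʳ (⊕-congˡ (thetaSum≈halfThetaTo M))) (regroup (halfThetaTerm M) one (halfThetaTo M)))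
  where
  regroup : ∀ t o v → t ⊕ (o ⊕ v ⊕ v) ⊕ t ≈ o ⊕ (v ⊕ t) ⊕ (v ⊕ t)
  regroup = solve 3 (λ t o v → t :+ (o :+ v :+ v) :+ t := o :+ (v :+ t) :+ (v :+ t)) ≈-refl

halfThetaTo-suc≈[] : ∀ M → halfThetaTo (suc M) ≈[ suc M ] halfThetaTo M
halfThetaTo-suc≈[] M = ≈[]-trans (⊕-cong[] ≈[]-refl (≈[]-weaken (ℕ.m≤m+n (suc M) _) (monomial≈[]𝟘 _ _)))
  (≈⇒≈[] (⊕-identityʳ (halfThetaTo M)))

thetaSum≈[]theta : ∀ M → thetaSum M ≈[ suc M ] theta
thetaSum≈[]theta M = ≈[]-trans (≈⇒≈[] (thetaSum≈halfThetaTo M))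
  (⊕-cong[] (⊕-cong[] ≈[]-refl toHalfTheta) toHalfTheta)
  where
  toHalfTheta : halfThetaTo M ≈[ suc M ] halfTheta
  toHalfTheta = ≈[]-sym (diagonal≈[] halfThetaTo halfThetaTo-suc≈[] M)

gauss≈[] : ∀ M → theta ⊗ evenProd 0 M ≈[ suc M ] (oddProd M 0 ⊗ evenProd 0 M) ⊗ (oddProd M 0 ⊗ evenProd 0 M)
gauss≈[] M = ≈[]-trans (⊗-cong[] (≈[]-sym (thetaSum≈[]theta M)) ≈[]-refl)
  (≈[]-trans (⊗-cong[] (≈[]-sym (jacobiSum-⊗-evenProd≈[] M)) ≈[]-refl)
  (≈⇒≈[] (≈-trans (⊗-congʳ (⊗-congʳ (jacobi-triple-product M M))) (regroup (oddProd M 0) (evenProd 0 M)))))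
  where
  regroup : ∀ o r → ((o ⊗ o) ⊗ r) ⊗ r ≈ (o ⊗ r) ⊗ (o ⊗ r)
  regroup = solve 2 (λ o r → ((o :* o) :* r) :* r := (o :* r) :* (o :* r)) ≈-refl

qPoch : ℕ → Series
qPoch K = prodTo K oneMinusQ^

qPoch₂ : ℕ → Series
qPoch₂ K = prodTo K (λ k → oneMinusQ^ (2 ℕ.* k))

qPochInv : ℕ → Series
qPochInv K = prodTo K (λ k → invOneMinusQ^suc (k ∸ 1))

qPoch₂≈evenProd : ∀ N → qPoch₂ N ≈ evenProd 0 N
qPoch₂≈evenProd zero    = ≈-refl
qPoch₂≈evenProd (suc N) = ≈-trans (prodTo-suc N _)
  (≈-trans (⊗-cong (qPoch₂≈evenProd N) (oneMinusQ^≈1-q^ _)) (≈-sym (evenProd-unfoldʳ 0 N)))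

qPoch-suc : ∀ K → qPoch (suc K) ≈ qPoch K ⊗ 1-q^ (suc K)
qPoch-suc K = ≈-trans (prodTo-suc K _) (⊗-congˡ (oneMinusQ^≈1-q^ K))

oddProd-⊗-evenProd : ∀ M → oddProd M 0 ⊗ evenProd 0 M ≈ qPoch (M ℕ.+ M)
oddProd-⊗-evenProd zero    = ⊗-identityˡ one
oddProd-⊗-evenProd (suc M) = begin
    oddProd (suc M) 0 ⊗ evenProd 0 (suc M)
  ≈⟨ ⊗-cong (oddProd-unfoldʳ M 0) (evenProd-unfoldʳ 0 M) ⟩
    (oddProd M 0 ⊗ 1-q^ (2 ℕ.* M ℕ.+ 1)) ⊗ (evenProd 0 M ⊗ 1-q^ (2 ℕ.* suc M))
  ≈⟨ regroup _ _ _ _ ⟩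
    ((oddProd M 0 ⊗ evenProd 0 M) ⊗ 1-q^ (2 ℕ.* M ℕ.+ 1)) ⊗ 1-q^ (2 ℕ.* suc M)
  ≈⟨ ⊗-cong (⊗-cong (oddProd-⊗-evenProd M) (1-q^-≡ (lemma₁ M))) (1-q^-≡ (lemma₂ M)) ⟩
    (qPoch (M ℕ.+ M) ⊗ 1-q^ (suc (M ℕ.+ M))) ⊗ 1-q^ (suc (suc (M ℕ.+ M)))
  ≈⟨ ⊗-cong (qPoch-suc (M ℕ.+ M)) ≈-refl ⟨
    qPoch (suc (M ℕ.+ M)) ⊗ 1-q^ (suc (suc (M ℕ.+ M)))
  ≈⟨ qPoch-suc (suc (M ℕ.+ M)) ⟨
    qPoch (suc (suc (M ℕ.+ M)))
  ≡⟨ cong (λ k → qPoch (suc k)) (ℕ.+-suc M M) ⟨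
    qPoch (suc M ℕ.+ suc M) ∎
  where
  open SeriesReasoning
  regroup : ∀ o a e b → (o ⊗ a) ⊗ (e ⊗ b) ≈ ((o ⊗ e) ⊗ a) ⊗ b
  regroup = solve 4 (λ o a e b → (o :* a) :* (e :* b) := ((o :* e) :* a) :* b) ≈-refl
  lemma₁ : ∀ M → 2 ℕ.* M ℕ.+ 1 ≡ suc (M ℕ.+ M)
  lemma₁ = ℕ-solve-∀
  lemma₂ : ∀ M → 2 ℕ.* suc M ≡ suc (suc (M ℕ.+ M))
  lemma₂ = ℕ-solve-∀

qPoch-suc≈[] : ∀ K → qPoch (suc K) ≈[ suc K ] qPoch K
qPoch-suc≈[] K = ≈[]-trans (≈⇒≈[] (qPoch-suc K))
  (≈[]-trans (⊗-cong[] ≈[]-refl (1-q^≈[]one (suc K))) (≈⇒≈[] (⊗-identityʳ (qPoch K))))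

qPochInv-⊗-qPoch : ∀ N → qPochInv N ⊗ qPoch N ≈ one
qPochInv-⊗-qPoch N = ≈-trans (prodTo-⊗ N _ _)
  (≈-trans (prodTo-cong N (λ k → ≈-trans (⊗-congˡ (oneMinusQ^≈1-q^ k)) (invOneMinusQ^suc-inverse k)))
           (prodTo-one N))

gauss≈[]qPoch : ∀ N → theta ⊗ qPoch₂ N ≈[ suc N ] qPoch N ⊗ qPoch N
gauss≈[]qPoch N = ≈[]-trans (≈⇒≈[] (⊗-congˡ (qPoch₂≈evenProd N))) (≈[]-trans (gauss≈[] N)
  (≈[]-trans (≈⇒≈[] (⊗-cong (oddProd-⊗-evenProd N) (oddProd-⊗-evenProd N)))
             (⊗-cong[] qPoch-stable qPoch-stable)))
  where
  qPoch-stable : qPoch (N ℕ.+ N) ≈[ suc N ] qPoch N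
  qPoch-stable = ≈[]-stable qPoch qPoch-suc≈[] N N

genTrunc≈ : ∀ N → genTrunc N ≈ pow (qPoch₂ N) 5 ⊗ pow (qPochInv N) 10
genTrunc≈ N = ≈-trans (⊛≈⊗ _ _) (⊗-cong (prodTo-pow N _ 5) (prodTo-pow N _ 10))

-- genTrunc N · φ(-q)^5 = (φ(-q) (q²; q²)_N / (q; q)_N²)^5
genTrunc-⊗-theta^5≈[] : ∀ N → genTrunc N ⊗ pow theta 5 ≈[ suc N ] one
genTrunc-⊗-theta^5≈[] N = ≈[]-trans (≈⇒≈[] as-fifth-power) (≈[]-trans (pow-cong[] base≈[]one 5) (≈⇒≈[] (pow-one 5)))
  where
  A I : Series
  A = qPoch₂ N
  I = qPochInv N
  regroup : ∀ t a i → (t ⊗ a) ⊗ (i ⊗ i) ≈ (a ⊗ (i ⊗ i)) ⊗ t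
  regroup = solve 3 (λ t a i → (t :* a) :* (i :* i) := (a :* (i :* i)) :* t) ≈-refl
  as-fifth-power : genTrunc N ⊗ pow theta 5 ≈ pow ((theta ⊗ A) ⊗ (I ⊗ I)) 5
  as-fifth-power = ≈-trans (⊗-congʳ (genTrunc≈ N)) (≈-trans (⊗-congʳ (⊗-congˡ (pow-+ I 5 5)))
    (≈-sym (≈-trans (pow-⊗ _ _ 5) (≈-trans (⊗-cong (pow-⊗ theta A 5) (pow-⊗ I I 5)) (regroup (pow theta 5) (pow A 5) (pow I 5))))))
  regroup′ : ∀ b i → (b ⊗ b) ⊗ (i ⊗ i) ≈ (i ⊗ b) ⊗ (i ⊗ b)
  regroup′ = solve 2 (λ b i → (b :* b) :* (i :* i) := (i :* b) :* (i :* b)) ≈-refl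
  base≈[]one : (theta ⊗ A) ⊗ (I ⊗ I) ≈[ suc N ] one
  base≈[]one = ≈[]-trans (⊗-cong[] (gauss≈[]qPoch N) ≈[]-refl)
    (≈⇒≈[] (≈-trans (regroup′ (qPoch N) I) (≈-trans (⊗-cong (qPochInv-⊗-qPoch N) (qPochInv-⊗-qPoch N)) (⊗-identityˡ one))))

genTrunc-suc≈[] : ∀ N → genTrunc (suc N) ≈[ suc N ] genTrunc N
genTrunc-suc≈[] N = ⊛-cong[] (lastFactor≈[]one F (oneMinusQ^ (2 ℕ.* suc N)) 5 evenFactor)
                             (lastFactor≈[]one G (invOneMinusQ^suc N) 10 (invOneMinusQ^suc≈[]one N))
  where
  F G : ℕ → Series
  F k = pow (oneMinusQ^ (2 ℕ.* k)) 5
  G k = pow (invOneMinusQ^suc (k ∸ 1)) 10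
  evenFactor : oneMinusQ^ (2 ℕ.* suc N) ≈[ suc N ] one
  evenFactor = ≈[]-trans (≈⇒≈[] (oneMinusQ^≈1-q^ _)) (≈[]-weaken (ℕ.m≤m+n (suc N) _) (1-q^≈[]one (2 ℕ.* suc N)))
  lastFactor≈[]one : ∀ (H : ℕ → Series) f e → f ≈[ suc N ] one → prodTo N H ⊛ pow f e ≈[ suc N ] prodTo N H
  lastFactor≈[]one H f e f≈1 =
    ≈[]-trans (⊛-cong[] {f = prodTo N H} ≈[]-refl (≈[]-trans (pow-cong[] f≈1 e) (≈⇒≈[] (pow-one e))))
              (≈⇒≈[] (≈-trans (⊛≈⊗ _ one) (⊗-identityʳ _)))

pbar-5-⊗-theta^5 : pbar-5 ⊗ pow theta 5 ≈ one
pbar-5-⊗-theta^5 = mk≈ λ n → trans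
  (below (⊗-cong[] (diagonal≈[] genTrunc genTrunc-suc≈[] n) ≈[]-refl) n ℕ.≤-refl)
  (below (genTrunc-⊗-theta^5≈[] n) n ℕ.≤-refl)

-- Inverting (1 + 2u)^5 modulo 2^7

linearCombination : ∀ {k} → List (ℤ × Polynomial k) → Polynomial k
linearCombination []             = con 0ℤ
linearCombination ((c , e) ∷ ts) = con c :* e :+ linearCombination ts

powExpr : ∀ {k} → Polynomial k → ℕ → Polynomial k
powExpr e zero    = con 1ℤ
powExpr e (suc m) = e :* powExpr e m

pow≈powExpr : ∀ {k} (e : Polynomial k) ρ m → pow (⟦ e ⟧ ρ) m ≈ ⟦ powExpr e m ⟧ ρ
pow≈powExpr e ρ zero    = one≈const1
pow≈powExpr e ρ (suc m) = ≈-trans (pow-suc _ m) (⊗-congˡ (pow≈powExpr e ρ m))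

-- P(u) = Σ_{m ≤ 6} (-2)^m C(m+4, 4) u^m: the expansion of (1 + 2u)^{-5} up to its first
-- coefficient divisible by 2^7
inverseCoeff : ℕ → ℤ
inverseCoeff m = (- ℤ.+ 2) ℤ.^ m * ℤ.+ ((m ℕ.+ 4) C 4)

inverseExpr : ∀ {k} → Polynomial k → Polynomial k
inverseExpr u = linearCombination (applyUpTo (λ m → inverseCoeff m , powExpr u m) 7)

-- Q(u), the quotient (1 - (1 + 2u)^5 P(u)) / (2^7 u^7)
remainderExpr : ∀ {k} → Polynomial k → Polynomial k
remainderExpr u = linearCombination (applyUpTo (λ m → Q m , powExpr u m) 5)
  where
  Q : ℕ → ℤ
  Q 0 = - ℤ.+ 330
  Q 1 = - ℤ.+ 2310
  Q 2 = - ℤ.+ 6160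
  Q 3 = - ℤ.+ 7392
  Q 4 = - ℤ.+ 3360
  Q _ = 0ℤ

thetaExpr : ∀ {k} → Polynomial k → Polynomial k
thetaExpr u = con 1ℤ :+ u :+ u

⟦_⟧[_] : Polynomial 1 → Series → Series
⟦ e ⟧[ u ] = ⟦ e ⟧ (u ∷ [])

𝑢 : Polynomial 1
𝑢 = var zero

inverse-mod-2^7 : ∀ x u → x ⊗ ⟦ powExpr (thetaExpr 𝑢) 5 ⟧[ u ] ≈ one →
  x ≈ ⟦ inverseExpr 𝑢 ⟧[ u ] ⊕ const (ℤ.+ 128) ⊗ (x ⊗ ⟦ powExpr 𝑢 7 :* remainderExpr 𝑢 ⟧[ u ])
inverse-mod-2^7 x u x⊗θ⁵≈1 = ≈-trans (identity x u) (⊕-congʳ (≈-trans (⊗-congˡ x⊗θ⁵≈1) (⊗-identityʳ _)))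
  where
  identity : ∀ x u → x ≈ ⟦ inverseExpr 𝑢 ⟧[ u ] ⊗ (x ⊗ ⟦ powExpr (thetaExpr 𝑢) 5 ⟧[ u ])
                         ⊕ const (ℤ.+ 128) ⊗ (x ⊗ ⟦ powExpr 𝑢 7 :* remainderExpr 𝑢 ⟧[ u ])
  identity = solve 2 (λ x u → x := inverseExpr u :* (x :* powExpr (thetaExpr u) 5)
                                    :+ con (ℤ.+ 128) :* (x :* (powExpr u 7 :* remainderExpr u))) ≈-refl

Exponents : Set
Exponents = ℕ × ℕ × ℕ

exponentsUpTo : ℕ → List Exponents
exponentsUpTo d = concatMap (λ m → concatMap (λ i → applyUpTo (λ j → i , j , m ∸ i ∸ j) (suc (m ∸ i))) (upTo (suc m)))
                            (upTo (suc d))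

expansionCoeff : Exponents → ℤ
expansionCoeff (i , j , k) = inverseCoeff (i ℕ.+ j ℕ.+ k) * ℤ.+ (((i ℕ.+ j ℕ.+ k) C i) ℕ.* ((j ℕ.+ k) C j))

𝑎 𝑏 𝑐 : Polynomial 3
𝑎 = var zero
𝑏 = var (suc zero)
𝑐 = var (suc (suc zero))

monomialExpr : Exponents → Polynomial 3
monomialExpr (i , j , k) = powExpr 𝑎 i :* (powExpr 𝑏 j :* powExpr 𝑐 k)

expansion : List (ℤ × Exponents)
expansion = map (λ t → expansionCoeff t , t) (exponentsUpTo 6)

expansionExpr : Polynomial 3
expansionExpr = linearCombination (map (λ (c , t) → c , monomialExpr t) expansion)

inverse-expansion : ∀ a b c → ⟦ inverseExpr 𝑢 ⟧[ a ⊕ b ⊕ c ] ≈ ⟦ expansionExpr ⟧ (a ∷ b ∷ c ∷ [])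
inverse-expansion a b c = prove (a ∷ b ∷ c ∷ []) (inverseExpr (𝑎 :+ 𝑏 :+ 𝑐)) expansionExpr ≈-refl

-- Residue classes modulo 8

record SupportedOn (r : ℕ) (f : Series) : Set where
  constructor supported
  field vanishes : ∀ n → n % 8 ≢ r % 8 → f n ≡ 0ℤ
open SupportedOn public

supportedOn-⊗ : ∀ {r s f g} → SupportedOn r f → SupportedOn s g → SupportedOn (r ℕ.+ s) (f ⊗ g)
supportedOn-⊗ {r} {s} {f} {g} f∈r g∈s = supported λ n n∉r+s →
  trans (at (≈⊛⊗ f g) n) (trans (sumTo-cong-≤ n (term≡0 n n∉r+s)) (sumTo-zero n))
  where
  term≡0 : ∀ n → n % 8 ≢ (r ℕ.+ s) % 8 → ∀ i → i ℕ.≤ n → f i * g (n ∸ i) ≡ 0ℤ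
  term≡0 n n∉r+s i i≤n with i % 8 ℕ.≟ r % 8 | (n ∸ i) % 8 ℕ.≟ s % 8
  ... | no i∉r  | _         = cong (_* g (n ∸ i)) (vanishes f∈r i i∉r)
  ... | yes _   | no n-i∉s  = trans (cong (f i *_) (vanishes g∈s (n ∸ i) n-i∉s)) (ℤ.*-zeroʳ (f i))
  ... | yes i∈r | yes n-i∈s = ⊥-elim (n∉r+s (begin
    n % 8                           ≡⟨ cong (_% 8) (ℕ.m+[n∸m]≡n i≤n) ⟨
    (i ℕ.+ (n ∸ i)) % 8             ≡⟨ %-distribˡ-+ i (n ∸ i) 8 ⟩
    (i % 8 ℕ.+ (n ∸ i) % 8) % 8     ≡⟨ cong₂ (λ x y → (x ℕ.+ y) % 8) i∈r n-i∈s ⟩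
    (r % 8 ℕ.+ s % 8) % 8           ≡⟨ %-distribˡ-+ r s 8 ⟨
    (r ℕ.+ s) % 8                   ∎))
    where open ≡-Reasoning

supportedOn-const : ∀ c → SupportedOn 0 (const c)
supportedOn-const c = supported λ where
  zero    0≢0 → ⊥-elim (0≢0 refl)
  (suc n) _   → refl

supportedOn-powExpr : ∀ {k r} (e : Polynomial k) ρ m →
                      SupportedOn r (⟦ e ⟧ ρ) → SupportedOn (m ℕ.* r) (⟦ powExpr e m ⟧ ρ)
supportedOn-powExpr e ρ zero    _   = supportedOn-const 1ℤ
supportedOn-powExpr e ρ (suc m) e∈r = supportedOn-⊗ e∈r (supportedOn-powExpr e ρ m e∈r)

restrict : ℕ → Series → Series
restrict r f n = if n % 8 ℕ.≡ᵇ r then f n else 0ℤ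

supportedOn-restrict : ∀ r f → SupportedOn r (restrict r f)
supportedOn-restrict r f = supported vanish
  where
  vanish : ∀ n → n % 8 ≢ r % 8 → restrict r f n ≡ 0ℤ
  vanish n n∉r with n % 8 ℕ.≡ᵇ r in eq
  ... | true  = ⊥-elim (n∉r (trans (sym (m%n%n≡m%n n 8)) (cong (_% 8) (ℕ.≡ᵇ⇒≡ (n % 8) r (subst IsTrue (sym eq) tt)))))
  ... | false = refl

isSquareResidue : ℕ → Bool
isSquareResidue r = (r ℕ.≡ᵇ 0) ∨ (r ℕ.≡ᵇ 1) ∨ (r ℕ.≡ᵇ 4)

squares-mod-8 : ∀ k → isSquareResidue (square k % 8) ≡ true
squares-mod-8 k = subst (λ r → isSquareResidue r ≡ true) (sym (%-distribˡ-* k k 8)) (residue (k % 8) (m%n<n k 8))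
  where
  residue : ∀ r → r ℕ.< 8 → isSquareResidue ((r ℕ.* r) % 8) ≡ true
  residue 0 _ = refl
  residue 1 _ = refl
  residue 2 _ = refl
  residue 3 _ = refl
  residue 4 _ = refl
  residue 5 _ = refl
  residue 6 _ = refl
  residue 7 _ = refl
  residue (suc (suc (suc (suc (suc (suc (suc (suc _)))))))) (s≤s (s≤s (s≤s (s≤s (s≤s (s≤s (s≤s (s≤s ()))))))))

halfThetaTo-nonsquare : ∀ M n → isSquareResidue (n % 8) ≡ false → halfThetaTo M n ≡ 0ℤ
halfThetaTo-nonsquare zero    n _          = refl
halfThetaTo-nonsquare (suc M) n nonsquare = trans (⊕-at _ _ n)
  (cong₂ _+_ (halfThetaTo-nonsquare M n nonsquare) (trans (monomial-coeff _ _ n) lastTerm))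
  where
  lastTerm : (if n ℕ.≡ᵇ square (suc M) then sign (suc M) else 0ℤ) ≡ 0ℤ
  lastTerm with n ℕ.≡ᵇ square (suc M) in eq
  ... | true  = case trans (sym nonsquare) (subst (λ m → isSquareResidue (m % 8) ≡ true)
                 (sym (ℕ.≡ᵇ⇒≡ n _ (subst IsTrue (sym eq) tt))) (squares-mod-8 (suc M))) of λ ()
  ... | false = refl

U₁ U₄ U₀ : Series
U₁ = restrict 1 halfTheta
U₄ = restrict 4 halfTheta
U₀ = restrict 0 halfTheta

halfTheta-split : halfTheta ≈ U₁ ⊕ U₄ ⊕ U₀
halfTheta-split = mk≈ λ n → sym (trans (⊕-at _ _ n) (trans (cong (_+ U₀ n) (⊕-at _ _ n)) (by-residue n)))
  where
  U : Series
  U = halfTheta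
  nonsquare : ∀ n → isSquareResidue (n % 8) ≡ false → 0ℤ ≡ U n
  nonsquare n ns = sym (halfThetaTo-nonsquare n n ns)
  by-residue : ∀ n → restrict 1 U n + restrict 4 U n + restrict 0 U n ≡ U n
  by-residue n with n % 8 in eq
  ... | 0 = ℤ.+-identityˡ (U n)
  ... | 1 = trans (ℤ.+-identityʳ _) (ℤ.+-identityʳ _)
  ... | 2 = nonsquare n (cong isSquareResidue eq)
  ... | 3 = nonsquare n (cong isSquareResidue eq)
  ... | 4 = trans (ℤ.+-identityʳ _) (ℤ.+-identityˡ _)
  ... | 5 = nonsquare n (cong isSquareResidue eq)
  ... | 6 = nonsquare n (cong isSquareResidue eq)
  ... | 7 = nonsquare n (cong isSquareResidue eq)
  ... | suc (suc (suc (suc (suc (suc (suc (suc r))))))) = case subst (ℕ._< 8) eq (m%n<n n 8) of λ where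
    (s≤s (s≤s (s≤s (s≤s (s≤s (s≤s (s≤s (s≤s ())))))))) 

-- The exponent of 2 claimed to divide the coefficients of q^n with n ≡ r (mod 8).
twoAdicBound : ℕ → ℕ
twoAdicBound 1 = 1
twoAdicBound 2 = 2
twoAdicBound 3 = 3
twoAdicBound 4 = 1
twoAdicBound 5 = 3
twoAdicBound 6 = 3
twoAdicBound 7 = 7
twoAdicBound _ = 0

2^ : ℕ → ℤ
2^ e = ℤ.+ (2 ℕ.^ e)

2^twoAdicBound∣128 : ∀ r → 2^ (twoAdicBound r) ∣ ℤ.+ 128
2^twoAdicBound∣128 0 = divides (ℤ.+ 128) refl
2^twoAdicBound∣128 1 = divides (ℤ.+ 64) refl
2^twoAdicBound∣128 2 = divides (ℤ.+ 32) refl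
2^twoAdicBound∣128 3 = divides (ℤ.+ 16) refl
2^twoAdicBound∣128 4 = divides (ℤ.+ 64) refl
2^twoAdicBound∣128 5 = divides (ℤ.+ 16) refl
2^twoAdicBound∣128 6 = divides (ℤ.+ 16) refl
2^twoAdicBound∣128 7 = divides (ℤ.+ 1) refl
2^twoAdicBound∣128 (suc (suc (suc (suc (suc (suc (suc (suc _)))))))) = divides (ℤ.+ 128) refl

residueClass : Exponents → ℕ
residueClass (i , j , k) = i ℕ.* 1 ℕ.+ (j ℕ.* 4 ℕ.+ k ℕ.* 0)

ClassDivisible : ℤ × Exponents → Set
ClassDivisible (c , t) = 2^ (twoAdicBound (residueClass t % 8)) ∣ c

expansion-classDivisible : All ClassDivisible expansion
expansion-classDivisible = from-yes (all? (λ (c , t) → 2^ (twoAdicBound (residueClass t % 8)) ∣? c) expansion)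

module _ {a b c : Series} (a∈1 : SupportedOn 1 a) (b∈4 : SupportedOn 4 b) (c∈0 : SupportedOn 0 c) where

  ρ : Vec Series 3
  ρ = a ∷ b ∷ c ∷ []

  supportedOn-monomialExpr : ∀ t → SupportedOn (residueClass t) (⟦ monomialExpr t ⟧ ρ)
  supportedOn-monomialExpr (i , j , k) = supportedOn-⊗ (supportedOn-powExpr 𝑎 ρ i a∈1)
    (supportedOn-⊗ (supportedOn-powExpr 𝑏 ρ j b∈4) (supportedOn-powExpr 𝑐 ρ k c∈0))

  linearCombination-divisible : ∀ ts → All ClassDivisible ts → ∀ n →
    2^ (twoAdicBound (n % 8)) ∣ ⟦ linearCombination (map (λ (c , t) → c , monomialExpr t) ts) ⟧ ρ n
  linearCombination-divisible [] [] n = divides 0ℤ (lemma n)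
    where
    lemma : ∀ n → const 0ℤ n ≡ 0ℤ * 2^ (twoAdicBound (n % 8))
    lemma zero    = refl
    lemma (suc n) = refl
  linearCombination-divisible ((d , t) ∷ ts) (d-divisible ∷ ts-divisible) n =
    subst (2^ (twoAdicBound (n % 8)) ∣_) (sym (trans (⊕-at _ _ n) (cong (_+ _) (at (const-⊗ d (⟦ monomialExpr t ⟧ ρ)) n))))
      (∣m∣n⇒∣m+n term-divisible (linearCombination-divisible ts ts-divisible n))
    where
    term-divisible : 2^ (twoAdicBound (n % 8)) ∣ d * ⟦ monomialExpr t ⟧ ρ n
    term-divisible with n % 8 ℕ.≟ residueClass t % 8
    ... | yes n∈t = ∣m⇒∣m*n _ (subst (λ r → 2^ (twoAdicBound r) ∣ d) (sym n∈t) d-divisible)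
    ... | no  n∉t = subst (_ ∣_) (sym (trans (cong (d *_) (vanishes (supportedOn-monomialExpr t) n n∉t)) (ℤ.*-zeroʳ d)))
                          (divides 0ℤ refl)

pbar-5-mod-2^7 : pbar-5 ≈ ⟦ expansionExpr ⟧ (U₁ ∷ U₄ ∷ U₀ ∷ [])
                       ⊕ const (ℤ.+ 128) ⊗ (pbar-5 ⊗ ⟦ powExpr 𝑢 7 :* remainderExpr 𝑢 ⟧[ U₁ ⊕ U₄ ⊕ U₀ ])
pbar-5-mod-2^7 = ≈-trans (inverse-mod-2^7 pbar-5 (U₁ ⊕ U₄ ⊕ U₀) (≈-trans (⊗-congˡ (≈-sym theta^5≈)) pbar-5-⊗-theta^5))
                         (⊕-congʳ (inverse-expansion U₁ U₄ U₀))
  where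
  theta^5≈ : pow theta 5 ≈ ⟦ powExpr (thetaExpr 𝑢) 5 ⟧[ U₁ ⊕ U₄ ⊕ U₀ ]
  theta^5≈ = ≈-trans (pow-cong (⊕-cong (⊕-cong one≈const1 halfTheta-split) halfTheta-split) 5)
                     (pow≈powExpr (thetaExpr 𝑢) (U₁ ⊕ U₄ ⊕ U₀ ∷ []) 5)

pbar-5-divisible : ∀ n → 2^ (twoAdicBound (n % 8)) ∣ pbar-5 n
pbar-5-divisible n = subst (2^ (twoAdicBound (n % 8)) ∣_) (sym coefficient)
  (∣m∣n⇒∣m+n (linearCombination-divisible U₁∈1 U₄∈4 U₀∈0 expansion expansion-classDivisible n)
             (∣m⇒∣m*n (W n) (2^twoAdicBound∣128 (n % 8))))
  where
  U₁∈1 : SupportedOn 1 U₁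
  U₁∈1 = supportedOn-restrict 1 halfTheta
  U₄∈4 : SupportedOn 4 U₄
  U₄∈4 = supportedOn-restrict 4 halfTheta
  U₀∈0 : SupportedOn 0 U₀
  U₀∈0 = supportedOn-restrict 0 halfTheta
  E W : Series
  E = ⟦ expansionExpr ⟧ (U₁ ∷ U₄ ∷ U₀ ∷ [])
  W = pbar-5 ⊗ ⟦ powExpr 𝑢 7 :* remainderExpr 𝑢 ⟧[ U₁ ⊕ U₄ ⊕ U₀ ]
  coefficient : pbar-5 n ≡ E n + ℤ.+ 128 * W n
  coefficient = trans (at pbar-5-mod-2^7 n) (trans (⊕-at _ _ n) (cong (E n +_) (at (const-⊗ (ℤ.+ 128) W) n)))

theorem1p1 : (n : ℕ) →
    ((ℤ.+ 2) ∣ᵤ pbar-5 (8 ℕ.* n ℕ.+ 1)) ×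
    ((ℤ.+ 4) ∣ᵤ pbar-5 (8 ℕ.* n ℕ.+ 2)) ×
    ((ℤ.+ 8) ∣ᵤ pbar-5 (8 ℕ.* n ℕ.+ 3)) ×
    ((ℤ.+ 2) ∣ᵤ pbar-5 (8 ℕ.* n ℕ.+ 4)) ×
    ((ℤ.+ 8) ∣ᵤ pbar-5 (8 ℕ.* n ℕ.+ 5)) ×
    ((ℤ.+ 8) ∣ᵤ pbar-5 (8 ℕ.* n ℕ.+ 6)) ×
    ((ℤ.+ 128) ∣ᵤ pbar-5 (8 ℕ.* n ℕ.+ 7))
theorem1p1 n = divisible 1 , divisible 2 , divisible 3 , divisible 4 , divisible 5 , divisible 6 , divisible 7
  where
  divisible : ∀ r → 2^ (twoAdicBound (r % 8)) ∣ᵤ pbar-5 (8 ℕ.* n ℕ.+ r)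
  divisible r = ∣⇒∣ᵤ (subst (λ s → 2^ (twoAdicBound s) ∣ pbar-5 (8 ℕ.* n ℕ.+ r)) (residue r)
                           (pbar-5-divisible (8 ℕ.* n ℕ.+ r)))
    where
    residue : ∀ r → (8 ℕ.* n ℕ.+ r) % 8 ≡ r % 8
    residue r = trans (cong (_% 8) (trans (ℕ.+-comm (8 ℕ.* n) r) (cong (r ℕ.+_) (ℕ.*-comm 8 n)))) ([m+kn]%n≡m%n r n 8)
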